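{- Let $K=C_m\oplus C_m$ with $m\ge4$, let $g\in K$, let $f_1,f_2\in K$ and $x_1,\dots,x_m\in\mathbb Z$, and suppose $S=f_1^{m-1}\prod_{\nu=1}^m(x_\nu f_1+f_2)\in\Upsilon_u(K)$. (1) If $S'=f_1^{ -2}S(f_1+g)(f_1-g)\in\Upsilon(K)$, then $g=0$ and hence $S=S'$. (2) If $j\in[1,m]$ and $S'=f_1^{ -1}(x_jf_1+f_2)^{ -1}S(f_1+g)(x_jf_1+f_2-g)\in\Upsilon(K)$, then $g\in\{0,(x_j-1)f_1+f_2\}$ and hence $S=S'$. (3) If $j,k\in[1,m]$ are distinct and $S'=(x_jf_1+f_2)^{ -1}(x_kf_1+f_2)^{ -1}S(x_jf_1+f_2+g)(x_kf_1+f_2-g)\in\Upsilon(K)$, then $g\in\langle f_1\rangle$.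
   Context: A sequence over an abelian group $K$ is a finite unordered sequence of elements of $K$, i.e. an element of the free abelian monoid on $K$, written multiplicatively ($h^k$ is $k$ copies of $h$; products are concatenations). For a subsequence $T$ of $S$, $T^{ -1}S$ denotes $S$ with the terms of $T$ removed; e.g. $f_1^{ -2}S(f_1+g)(f_1-g)$ is obtained from $S$ by removing two copies of $f_1$ and adding the terms $f_1+g$ and $f_1-g$. A minimal zero-sum sequence is a nonempty sequence with sum $0$ having no nonempty proper subsequence with sum $0$. $\Upsilon(K)$ is the set of minimal zero-sum sequences $S$ over $K=C_m\oplus C_m$ for which there exist a basis $(e_1,e_2)$ of $K$ (i.e. $K=\langle e_1\rangle\oplus\langle e_2\rangle$, $e_1,e_2\ne0$) and integers $y_1,\dots,y_m\in[0,m-1]$ with $y_1+\dots+y_m\equiv1\pmod m$ such that $S=e_1^{m-1}\prod_{\nu=1}^m(y_\nu e_1+e_2)$. $\Upsilon_u(K)$ is the set of $S\in\Upsilon(K)$ having a unique element of multiplicity $m-1$. -}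

module Defs where

open import Data.Nat as ℕ using (ℕ; NonZero; _%_; _∸_)
open import Data.Fin as Fin using (Fin; toℕ; fromℕ<)
open import Data.Fin.Properties using () renaming (_≟_ to _≟F_)
open import Data.Integer as ℤ using (ℤ; +_; _%ℕ_)
open import Data.Integer.DivMod using (n%ℕd<d)
open import Data.Product using (_×_; _,_; Σ; ∃; ∃-syntax)
open import Data.Product.Properties using (≡-dec)
open import Data.List using (List; []; _∷_; _++_; map; length; filter; replicate; allFin; foldr)
open import Data.Nat.ListAction using (sum)
open import Data.List.Relation.Binary.Sublist.Propositional using (_⊆_)
open import Data.List.Relation.Binary.Permutation.Propositional using (_↭_)
open import Relation.Binary.PropositionalEquality using (_≡_; _≢_)
open import Relation.Binary.Definitions using (DecidableEquality)
open import Relation.Nullary using (¬_)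
open import Data.Vec.Functional using (updateAt)

-- The group K = C_m ⊕ C_m, realised as Z/mZ × Z/mZ with Z/mZ = Fin m.
module _ (m : ℕ) .{{_ : NonZero m}} where

  Zm : Set
  Zm = Fin m

  red : ℤ → Zm
  red x = fromℕ< (n%ℕd<d x m)

  K : Set
  K = Zm × Zm

  0K : K
  0K = red (+ 0) , red (+ 0)

  infixl 6 _⊕_ _⊖_
  infixr 7 _·_

  _⊕_ : K → K → K
  (a , b) ⊕ (c , d) = red (+ toℕ a ℤ.+ + toℕ c) , red (+ toℕ b ℤ.+ + toℕ d)

  _·_ : ℤ → K → K
  x · (a , b) = red (x ℤ.* + toℕ a) , red (x ℤ.* + toℕ b)

  _⊖_ : K → K → K
  h ⊖ k = h ⊕ (ℤ.-1ℤ · k)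

  _≟K_ : DecidableEquality K
  _≟K_ = ≡-dec _≟F_ _≟F_

  -- sequences over K: finite lists, considered up to permutation (_↭_)
  Seq : Set
  Seq = List K

  σ : Seq → K
  σ = foldr _⊕_ 0K

  mult : K → Seq → ℕ
  mult h S = length (filter (_≟K h) S)

  -- minimal zero-sum sequence (subsequences = sublists; proper = strictly shorter)
  MinZeroSum : Seq → Set
  MinZeroSum S = S ≢ [] × σ S ≡ 0K ×
    (∀ (T : Seq) → T ⊆ S → T ≢ [] → ℕ._<_ (length T) (length S) → σ T ≢ 0K)

  IsBasis : K → K → Set
  IsBasis e₁ e₂ = e₁ ≢ 0K × e₂ ≢ 0K ×
    (∀ (k : K) → ∃[ a ] ∃[ b ] k ≡ a · e₁ ⊕ b · e₂) ×
    (∀ (a b : ℤ) → a · e₁ ≡ b · e₂ → a · e₁ ≡ 0K)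

  Υ : Seq → Set
  Υ S = MinZeroSum S × Σ K λ e₁ → Σ K λ e₂ → IsBasis e₁ e₂ ×
    Σ (Fin m → Fin m) λ y →
      (sum (map (λ ν → toℕ (y ν)) (allFin m)) % m ≡ 1 % m) ×
      (S ↭ (replicate (m ∸ 1) e₁ ++ map (λ ν → (+ toℕ (y ν)) · e₁ ⊕ e₂) (allFin m)))

  Υu : Seq → Set
  Υu S = Υ S × Σ K λ h → mult h S ≡ m ∸ 1 × (∀ h' → mult h' S ≡ m ∸ 1 → h' ≡ h)

  term : K → K → (Fin m → ℤ) → Fin m → K
  term f₁ f₂ x ν = x ν · f₁ ⊕ f₂

  seqS : K → K → (Fin m → ℤ) → Seq
  seqS f₁ f₂ x = replicate (m ∸ 1) f₁ ++ map (term f₁ f₂ x) (allFin m)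

  -- f₁^{-2} S (f₁ + g)(f₁ - g)   (valid since m - 1 ≥ 2)
  seq₁ : K → K → (Fin m → ℤ) → K → Seq
  seq₁ f₁ f₂ x g = (f₁ ⊕ g) ∷ (f₁ ⊖ g) ∷ replicate (m ∸ 3) f₁ ++ map (term f₁ f₂ x) (allFin m)

  seq₂ : K → K → (Fin m → ℤ) → K → Fin m → Seq
  seq₂ f₁ f₂ x g j = (f₁ ⊕ g) ∷ replicate (m ∸ 2) f₁ ++
    map (updateAt (term f₁ f₂ x) j (λ u → u ⊖ g)) (allFin m)

  seq₃ : K → K → (Fin m → ℤ) → K → Fin m → Fin m → Seq
  seq₃ f₁ f₂ x g j k = replicate (m ∸ 1) f₁ ++
    map (updateAt (updateAt (term f₁ f₂ x) j (λ u → u ⊕ g)) k (λ u → u ⊖ g)) (allFin m)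

module Submission where

open import Defs
open import Level using (0ℓ)
open import Data.Nat as ℕ using (ℕ; zero; suc; NonZero; _≤_; _<_; s≤s; z≤n; _∸_)
import Data.Nat.Properties as ℕP
open import Data.Integer as ℤ using (ℤ; +_; +[1+_]; -[1+_]; _+_; _*_; -_; _-_; 0ℤ; 1ℤ; -1ℤ; _%ℕ_; _/ℕ_)
import Data.Integer.Properties as ℤP
open import Data.Integer.DivMod using (a≡a%ℕn+[a/ℕn]*n; n%ℕd<d)
open import Data.Integer.Tactic.RingSolver using (solve-∀)
open import Data.Fin as Fin using (Fin; toℕ)
import Data.Fin.Properties as FinP
open import Data.Vec.Functional using (updateAt)
import Data.Vec.Functional.Properties as VFP
open import Data.Product using (_,_; proj₁; proj₂; _×_; ∃-syntax)
open import Data.Sum using (_⊎_; inj₁; inj₂; [_,_]′)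
open import Data.List using (List; []; _∷_; _++_; map; length; filter; replicate; allFin; foldr; tabulate; [_])
open import Data.List.Membership.Propositional using (_∈_)
open import Data.List.Relation.Unary.Any using (here; there)
import Data.List.Relation.Unary.Any as Any
import Data.List.Relation.Unary.All as All
import Data.List.Membership.Propositional.Properties as MemP
import Data.List.Properties as LP
open import Data.List.Relation.Binary.Permutation.Propositional using (_↭_; prep; swap; ↭-sym; ↭-trans; ↭-refl; ↭-reflexive)
import Data.List.Relation.Binary.Permutation.Propositional as Perm
import Data.List.Relation.Binary.Permutation.Propositional.Properties as PermP
open import Data.List.Relation.Binary.Sublist.Propositional using (_⊆_)
import Data.List.Relation.Binary.Sublist.Propositional as Sub
import Data.List.Relation.Binary.Sublist.Propositional.Properties as SubP
open import Data.Empty using (⊥; ⊥-elim)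
open import Relation.Binary.PropositionalEquality hiding ([_])
open import Relation.Binary.Bundles using (Setoid)
open import Relation.Binary.Definitions using (DecidableEquality)
import Relation.Binary.Reasoning.Setoid as SetoidReasoning
open import Relation.Nullary using (¬_; Dec; yes; no)
open import Function using (_∘_)

-- K is (ℤ/m)², and points are tested against the alternating form det: when det c₁ c₂ is
-- a unit, a point h is determined by det c₁ h and det c₂ h.  A sequence in Υ has a basis
-- vector e₁ of multiplicity m - 1, and all its other terms lie on the line e₂ + ⟨e₁⟩.
-- For the modified sequence S' either e₁ = f₁, and counting multiplicities forces the
-- stated shape of g, or e₁ is one of the terms t i = x i f₁ + f₂.  In the latter case
-- every t ν still present in S' lies in {t i, t i + f₁}, and summing det (t i) over the
-- zero-sum sequence S shows that t i has multiplicity m - 1 in S, against the uniqueness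
-- required by Υu.  In (3), det f₁ g ≢ 0 would separate t j + g and t k - g from the
-- other t ν, which leaves no room for a term of multiplicity m - 1.

module Congruence (m : ℕ) where

  infix 4 _≈_
  record _≈_ (x y : ℤ) : Set where
    constructor _,_
    field
      quotient : ℤ
      difference : x - y ≡ quotient * + m

  ≡⇒≈ : ∀ {x y} → x ≡ y → x ≈ y
  ≡⇒≈ {x} refl = 0ℤ , trans (ℤP.+-inverseʳ x) (sym (ℤP.*-zeroˡ (+ m)))

  ≈-refl : ∀ {x} → x ≈ x
  ≈-refl = ≡⇒≈ refl

  ≈-sym : ∀ {x y} → x ≈ y → y ≈ x
  ≈-sym {x} {y} (q , p) = - q , trans (lemma x y) (trans (cong -_ p) (ℤP.neg-distribˡ-* q (+ m)))
    where
      lemma : ∀ x y → y - x ≡ - (x - y)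
      lemma = solve-∀

  ≈-trans : ∀ {x y z} → x ≈ y → y ≈ z → x ≈ z
  ≈-trans {x} {y} {z} (q , p) (r , s) =
    q + r , trans (lemma x y z) (trans (cong₂ _+_ p s) (sym (ℤP.*-distribʳ-+ (+ m) q r)))
    where
      lemma : ∀ x y z → x - z ≡ (x - y) + (y - z)
      lemma = solve-∀

  ≈-setoid : Setoid 0ℓ 0ℓ
  ≈-setoid = record
    { _≈_ = _≈_
    ; isEquivalence = record { refl = ≈-refl ; sym = ≈-sym ; trans = ≈-trans }
    }

  module ≈-Reasoning = SetoidReasoning ≈-setoid

  +-cong : ∀ {x y u v} → x ≈ y → u ≈ v → x + u ≈ y + v
  +-cong {x} {y} {u} {v} (q , p) (r , s) =
    q + r , trans (lemma x y u v) (trans (cong₂ _+_ p s) (sym (ℤP.*-distribʳ-+ (+ m) q r)))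
    where
      lemma : ∀ x y u v → (x + u) - (y + v) ≡ (x - y) + (u - v)
      lemma = solve-∀

  neg-cong : ∀ {x y} → x ≈ y → - x ≈ - y
  neg-cong {x} {y} (q , p) = - q , trans (lemma x y) (trans (cong -_ p) (ℤP.neg-distribˡ-* q (+ m)))
    where
      lemma : ∀ x y → - x - - y ≡ - (x - y)
      lemma = solve-∀

  -‿cong : ∀ {x y u v} → x ≈ y → u ≈ v → x - u ≈ y - v
  -‿cong p q = +-cong p (neg-cong q)

  *-congˡ : ∀ c {x y} → x ≈ y → c * x ≈ c * y
  *-congˡ c {x} {y} (q , p) = c * q , trans (lemma c x y) (trans (cong (c *_) p) (sym (ℤP.*-assoc c q (+ m))))
    where
      lemma : ∀ c x y → c * x - c * y ≡ c * (x - y)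
      lemma = solve-∀

  *-congʳ : ∀ c {x y} → x ≈ y → x * c ≈ y * c
  *-congʳ c {x} {y} p = ≈-trans (≡⇒≈ (ℤP.*-comm x c)) (≈-trans (*-congˡ c p) (≡⇒≈ (ℤP.*-comm c y)))

  *-cong : ∀ {x y u v} → x ≈ y → u ≈ v → x * u ≈ y * v
  *-cong {y = y} {u = u} p q = ≈-trans (*-congʳ u p) (*-congˡ y q)

  x+y≈x⇒y≈0 : ∀ {x y} → x + y ≈ x → y ≈ 0ℤ
  x+y≈x⇒y≈0 {x} {y} e =
    ≈-trans (≡⇒≈ (lemma x y)) (≈-trans (-‿cong e (≈-refl {x})) (≡⇒≈ (ℤP.+-inverseʳ x)))
    where
      lemma : ∀ x y → y ≡ x + y - x
      lemma = solve-∀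

  x-y≈x⇒y≈0 : ∀ {x y} → x - y ≈ x → y ≈ 0ℤ
  x-y≈x⇒y≈0 {x} {y} e =
    ≈-trans (≡⇒≈ (lemma x y)) (≈-trans (-‿cong (≈-refl {x}) e) (≡⇒≈ (ℤP.+-inverseʳ x)))
    where
      lemma : ∀ x y → y ≡ x - (x - y)
      lemma = solve-∀

  *m≈0 : ∀ k → k * + m ≈ 0ℤ
  *m≈0 k = k , ℤP.+-identityʳ (k * + m)

  m≈0 : + m ≈ 0ℤ
  m≈0 = ≈-trans (≡⇒≈ (sym (ℤP.*-identityˡ (+ m)))) (*m≈0 1ℤ)

  m*≈0 : ∀ k → + m * k ≈ 0ℤ
  m*≈0 k = ≈-trans (≡⇒≈ (ℤP.*-comm (+ m) k)) (*m≈0 k)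

  Unit : ℤ → Set
  Unit d = ∃[ d⁻¹ ] d * d⁻¹ ≈ 1ℤ

  Unit-resp-≈ : ∀ {d e} → d ≈ e → Unit d → Unit e
  Unit-resp-≈ d≈e (d⁻¹ , u) = d⁻¹ , ≈-trans (*-congʳ d⁻¹ (≈-sym d≈e)) u

  Unit-neg : ∀ {d} → Unit d → Unit (- d)
  Unit-neg {d} (d⁻¹ , u) = - d⁻¹ , ≈-trans (≡⇒≈ (lemma d d⁻¹)) u
    where
      lemma : ∀ a b → - a * - b ≡ a * b
      lemma = solve-∀

  Unit-cancelʳ : ∀ {d a b} → Unit d → a * d ≈ b * d → a ≈ b
  Unit-cancelʳ {d} {a} {b} (d⁻¹ , u) p = begin
    a                ≡⟨ ℤP.*-identityʳ a ⟨
    a * 1ℤ           ≈⟨ *-congˡ a u ⟨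
    a * (d * d⁻¹)    ≡⟨ ℤP.*-assoc a d d⁻¹ ⟨
    a * d * d⁻¹      ≈⟨ *-congʳ d⁻¹ p ⟩
    b * d * d⁻¹      ≡⟨ ℤP.*-assoc b d d⁻¹ ⟩
    b * (d * d⁻¹)    ≈⟨ *-congˡ b u ⟩
    b * 1ℤ           ≡⟨ ℤP.*-identityʳ b ⟩
    b                ∎
    where open ≈-Reasoning

  private
    quotient-nonpositive : ∀ {a b k} → a ℕ.< m → + a - + b ≡ +[1+ k ] * + m → ⊥
    quotient-nonpositive {a} {b} {k} a<m p = ℕP.<⇒≱ a<m (begin
      m                    ≤⟨ ℕP.m≤m+n m (k ℕ.* m) ⟩
      suc k ℕ.* m          ≤⟨ ℕP.m≤n+m _ b ⟩
      b ℕ.+ suc k ℕ.* m    ≡⟨ ℤP.+-injective a≡ ⟨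
      a                    ∎)
      where
        open ℕP.≤-Reasoning
        shift : ∀ x y → x ≡ y + (x - y)
        shift = solve-∀
        a≡ : + a ≡ + b + + (suc k ℕ.* m)
        a≡ = trans (shift (+ a) (+ b)) (cong (λ c → + b + c) (trans p (ℤP.+◃n≡+n _)))

  nat-≈⇒≡ : ∀ {a b} → a ℕ.< m → b ℕ.< m → + a ≈ + b → a ≡ b
  nat-≈⇒≡ {a} {b} _ _ (+ zero , p) =
    ℤP.+-injective (ℤP.i-j≡0⇒i≡j (+ a) (+ b) (trans p (ℤP.*-zeroˡ (+ m))))
  nat-≈⇒≡ {a} {b} a<m _ (+[1+ k ] , p) = ⊥-elim (quotient-nonpositive {a} {b} {k} a<m p)
  nat-≈⇒≡ {a} {b} _ b<m a≈b@(-[1+ k ] , _) =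
    ⊥-elim (quotient-nonpositive {b} {a} {k} b<m (_≈_.difference (≈-sym a≈b)))

  1≉0 : 1 ℕ.< m → ¬ 1ℤ ≈ 0ℤ
  1≉0 1<m 1≈0 with nat-≈⇒≡ 1<m (ℕP.<-trans ℕP.0<1+n 1<m) 1≈0
  ... | ()

  Unit⇒≉0 : 1 ℕ.< m → ∀ {d} → Unit d → ¬ d ≈ 0ℤ
  Unit⇒≉0 1<m {d} (d⁻¹ , u) d≈0 = 1≉0 1<m (begin
    1ℤ         ≈⟨ u ⟨
    d * d⁻¹    ≈⟨ *-congʳ d⁻¹ d≈0 ⟩
    0ℤ * d⁻¹   ≡⟨ ℤP.*-zeroˡ d⁻¹ ⟩
    0ℤ         ∎)
    where open ≈-Reasoning

  suc≈0⇒≡pred : 1 ℕ.< m → ∀ {M} → M ℕ.≤ m → + suc M ≈ 0ℤ → M ≡ m ∸ 1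
  suc≈0⇒≡pred 1<m {M} M≤m 1+M≈0 with ℕP.m≤n⇒m<n∨m≡n M≤m
  ... | inj₂ refl = ⊥-elim (1≉0 1<m (begin
    1ℤ             ≈⟨ +-cong (≈-refl {1ℤ}) m≈0 ⟨
    1ℤ + + m       ≈⟨ 1+M≈0 ⟩
    0ℤ             ∎))
    where open ≈-Reasoning
  ... | inj₁ M<m with ℕP.m≤n⇒m<n∨m≡n M<m
  ...   | inj₂ refl = refl
  ...   | inj₁ 1+M<m with nat-≈⇒≡ 1+M<m (ℕP.<-trans ℕP.0<1+n 1<m) 1+M≈0
  ...     | ()

sumOf : {A : Set} → (A → ℤ) → List A → ℤ
sumOf π = foldr (λ h s → π h + s) 0ℤ

module _ {A : Set} (π : A → ℤ) where

  sumOf-++ : ∀ xs ys → sumOf π (xs ++ ys) ≡ sumOf π xs + sumOf π ys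
  sumOf-++ [] ys = sym (ℤP.+-identityˡ _)
  sumOf-++ (x ∷ xs) ys = trans (cong (_+_ (π x)) (sumOf-++ xs ys)) (sym (ℤP.+-assoc (π x) _ _))

  sumOf-replicate : ∀ k a → sumOf π (replicate k a) ≡ + k * π a
  sumOf-replicate zero a = sym (ℤP.*-zeroˡ (π a))
  sumOf-replicate (suc k) a = trans (cong (_+_ (π a)) (sumOf-replicate k a)) (lemma (π a) (+ k))
    where
      lemma : ∀ d k → d + k * d ≡ (1ℤ + k) * d
      lemma = solve-∀

  sumOf-↭ : ∀ {xs ys} → xs ↭ ys → sumOf π xs ≡ sumOf π ys
  sumOf-↭ Perm.refl = refl
  sumOf-↭ (prep x p) = cong (_+_ (π x)) (sumOf-↭ p)
  sumOf-↭ (swap x y p) = trans (lemma (π x) (π y) _) (cong (λ s → π y + (π x + s)) (sumOf-↭ p))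
    where
      lemma : ∀ a b s → a + (b + s) ≡ b + (a + s)
      lemma = solve-∀
  sumOf-↭ (Perm.trans p q) = trans (sumOf-↭ p) (sumOf-↭ q)

module Coordinates (m : ℕ) .{{_ : NonZero m}} where
  open Congruence m

  ⟦_⟧ : Fin m → ℤ
  ⟦ a ⟧ = + toℕ a

  ⟦red⟧≈ : ∀ x → ⟦ red m x ⟧ ≈ x
  ⟦red⟧≈ x = - (x /ℕ m) , (begin
    + toℕ (red m x) - x                      ≡⟨ cong (λ r → + r - x) (FinP.toℕ-fromℕ< (n%ℕd<d x m)) ⟩
    + (x %ℕ m) - x                           ≡⟨ cong (λ y → + (x %ℕ m) - y) (a≡a%ℕn+[a/ℕn]*n x m) ⟩
    + (x %ℕ m) - (+ (x %ℕ m) + x /ℕ m * + m) ≡⟨ lemma (+ (x %ℕ m)) (x /ℕ m) (+ m) ⟩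
    - (x /ℕ m) * + m                         ∎)
    where
      open ≡-Reasoning
      lemma : ∀ r q k → r - (r + q * k) ≡ - q * k
      lemma = solve-∀

  ⟦⟧-≈⇒≡ : ∀ {a b : Fin m} → ⟦ a ⟧ ≈ ⟦ b ⟧ → a ≡ b
  ⟦⟧-≈⇒≡ {a} {b} e = FinP.toℕ-injective (nat-≈⇒≡ (FinP.toℕ<n a) (FinP.toℕ<n b) e)

  ≈-dec : ∀ x y → Dec (x ≈ y)
  ≈-dec x y with red m x FinP.≟ red m y
  ... | yes e = yes (≈-trans (≈-sym (⟦red⟧≈ x)) (≈-trans (≡⇒≈ (cong ⟦_⟧ e)) (⟦red⟧≈ y)))
  ... | no ne = no λ e → ne (⟦⟧-≈⇒≡ (≈-trans (⟦red⟧≈ x) (≈-trans e (≈-sym (⟦red⟧≈ y)))))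

  p₁ p₂ : K m → ℤ
  p₁ h = ⟦ proj₁ h ⟧
  p₂ h = ⟦ proj₂ h ⟧

  K-≡ : ∀ {h k} → p₁ h ≈ p₁ k → p₂ h ≈ p₂ k → h ≡ k
  K-≡ e₁ e₂ = cong₂ _,_ (⟦⟧-≈⇒≡ e₁) (⟦⟧-≈⇒≡ e₂)

  record Linear (π : K m → ℤ) : Set where
    field
      ⊕-hom : ∀ h k → π (_⊕_ m h k) ≈ π h + π k
      ·-hom : ∀ a h → π (_·_ m a h) ≈ a * π h
      0-hom : π (0K m) ≈ 0ℤ

    ⊖-hom : ∀ h k → π (_⊖_ m h k) ≈ π h - π k
    ⊖-hom h k = ≈-trans (⊕-hom h _) (+-cong (≈-refl {π h}) (≈-trans (·-hom -1ℤ k) (≡⇒≈ (ℤP.-1*i≡-i (π k)))))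

    affine : ∀ y e₁ e₂ → π (_⊕_ m (_·_ m y e₁) e₂) ≈ y * π e₁ + π e₂
    affine y e₁ e₂ = ≈-trans (⊕-hom _ e₂) (+-cong (·-hom y e₁) (≈-refl {π e₂}))

    σ-hom : ∀ xs → π (σ m xs) ≈ sumOf π xs
    σ-hom [] = 0-hom
    σ-hom (h ∷ xs) = ≈-trans (⊕-hom h (σ m xs)) (+-cong (≈-refl {π h}) (σ-hom xs))

  p₁-linear : Linear p₁
  p₁-linear = record { ⊕-hom = λ _ _ → ⟦red⟧≈ _ ; ·-hom = λ _ _ → ⟦red⟧≈ _ ; 0-hom = ⟦red⟧≈ _ }

  p₂-linear : Linear p₂
  p₂-linear = record { ⊕-hom = λ _ _ → ⟦red⟧≈ _ ; ·-hom = λ _ _ → ⟦red⟧≈ _ ; 0-hom = ⟦red⟧≈ _ }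

  linear-ext : ∀ {h k} → (∀ {π} → Linear π → π h ≈ π k) → h ≡ k
  linear-ext π-eq = K-≡ (π-eq p₁-linear) (π-eq p₂-linear)

  ⊕-identityʳ : ∀ h → _⊕_ m h (0K m) ≡ h
  ⊕-identityʳ h = linear-ext λ {π} lin → let open Linear lin in
    ≈-trans (⊕-hom h (0K m)) (≈-trans (+-cong (≈-refl {π h}) 0-hom) (≡⇒≈ (ℤP.+-identityʳ (π h))))

  ⊖-identityʳ : ∀ h → _⊖_ m h (0K m) ≡ h
  ⊖-identityʳ h = linear-ext λ {π} lin → let open Linear lin in
    ≈-trans (⊖-hom h (0K m)) (≈-trans (-‿cong (≈-refl {π h}) 0-hom) (≡⇒≈ (ℤP.+-identityʳ (π h))))

  ⊕-cancelˡ : ∀ {a g} → _⊕_ m a g ≡ a → g ≡ 0K m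
  ⊕-cancelˡ {a} {g} a+g≡a = linear-ext λ {π} lin → let open Linear lin in begin
    π g              ≡⟨ lemma (π a) (π g) ⟩
    (π a + π g) - π a ≈⟨ -‿cong (⊕-hom a g) (≈-refl {π a}) ⟨
    π (_⊕_ m a g) - π a ≡⟨ cong (λ h → π h - π a) a+g≡a ⟩
    π a - π a        ≡⟨ ℤP.+-inverseʳ (π a) ⟩
    0ℤ               ≈⟨ 0-hom ⟨
    π (0K m)         ∎
    where
      open ≈-Reasoning
      lemma : ∀ x y → y ≡ (x + y) - x
      lemma = solve-∀

  -- Opaque, so that det c h stays rigid when unifying with implicit arguments.
  opaque
    det : K m → K m → ℤ
    det h k = p₁ h * p₂ k - p₂ h * p₁ k

    det-cong : ∀ h k {x₁ x₂ y₁ y₂} → p₁ h ≈ x₁ → p₂ h ≈ x₂ → p₁ k ≈ y₁ → p₂ k ≈ y₂ →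
               det h k ≈ x₁ * y₂ - x₂ * y₁
    det-cong _ _ e₁ e₂ e₃ e₄ = -‿cong (*-cong e₁ e₄) (*-cong e₂ e₃)

    det-self : ∀ h → det h h ≡ 0ℤ
    det-self h = lemma (p₁ h) (p₂ h)
      where
        lemma : ∀ a b → a * b - b * a ≡ 0ℤ
        lemma = solve-∀

    det-antisym : ∀ h k → det h k ≡ - det k h
    det-antisym h k = lemma (p₁ h) (p₂ h) (p₁ k) (p₂ k)
      where
        lemma : ∀ a b c d → a * d - b * c ≡ - (c * b - d * a)
        lemma = solve-∀

    det-⊕ : ∀ c h k → det c (_⊕_ m h k) ≈ det c h + det c k
    det-⊕ c h k = ≈-trans
      (det-cong c (_⊕_ m h k) ≈-refl ≈-refl (Linear.⊕-hom p₁-linear h k) (Linear.⊕-hom p₂-linear h k))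
      (≡⇒≈ (lemma (p₁ c) (p₂ c) (p₁ h) (p₂ h) (p₁ k) (p₂ k)))
      where
        lemma : ∀ a b x y u v → a * (y + v) - b * (x + u) ≡ (a * y - b * x) + (a * v - b * u)
        lemma = solve-∀

    det-· : ∀ c a h → det c (_·_ m a h) ≈ a * det c h
    det-· c a h = ≈-trans
      (det-cong c (_·_ m a h) ≈-refl ≈-refl (Linear.·-hom p₁-linear a h) (Linear.·-hom p₂-linear a h))
      (≡⇒≈ (lemma (p₁ c) (p₂ c) (p₁ h) (p₂ h) a))
      where
        lemma : ∀ a b x y z → a * (z * y) - b * (z * x) ≡ z * (a * y - b * x)
        lemma = solve-∀

    det-0 : ∀ c → det c (0K m) ≈ 0ℤ
    det-0 c = ≈-trans
      (det-cong c (0K m) ≈-refl ≈-refl (Linear.0-hom p₁-linear) (Linear.0-hom p₂-linear))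
      (≡⇒≈ (lemma (p₁ c) (p₂ c)))
      where
        lemma : ∀ a b → a * 0ℤ - b * 0ℤ ≡ 0ℤ
        lemma = solve-∀

    cramer₁ : ∀ c₁ c₂ h → p₁ h * det c₁ c₂ ≡ det c₁ h * p₁ c₂ - det c₂ h * p₁ c₁
    cramer₁ c₁ c₂ h = lemma (p₁ c₁) (p₂ c₁) (p₁ c₂) (p₂ c₂) (p₁ h) (p₂ h)
      where
        lemma : ∀ p q r s x y → x * (p * s - q * r) ≡ (p * y - q * x) * r - (r * y - s * x) * p
        lemma = solve-∀

    cramer₂ : ∀ c₁ c₂ h → p₂ h * det c₁ c₂ ≡ det c₁ h * p₂ c₂ - det c₂ h * p₂ c₁
    cramer₂ c₁ c₂ h = lemma (p₁ c₁) (p₂ c₁) (p₁ c₂) (p₂ c₂) (p₁ h) (p₂ h)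
      where
        lemma : ∀ p q r s x y → y * (p * s - q * r) ≡ (p * y - q * x) * s - (r * y - s * x) * q
        lemma = solve-∀

    det-lincomb : ∀ a b c d e₁ e₂ →
      det (_⊕_ m (_·_ m a e₁) (_·_ m b e₂)) (_⊕_ m (_·_ m c e₁) (_·_ m d e₂)) ≈ (a * d - b * c) * det e₁ e₂
    det-lincomb a b c d e₁ e₂ = ≈-trans
      (det-cong _ _ (lincomb p₁-linear a b) (lincomb p₂-linear a b) (lincomb p₁-linear c d) (lincomb p₂-linear c d))
      (≡⇒≈ (lemma a b c d (p₁ e₁) (p₂ e₁) (p₁ e₂) (p₂ e₂)))
      where
        lincomb : ∀ {π} → Linear π → ∀ a b → π (_⊕_ m (_·_ m a e₁) (_·_ m b e₂)) ≈ a * π e₁ + b * π e₂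
        lincomb lin a b = ≈-trans (Linear.⊕-hom lin _ _) (+-cong (Linear.·-hom lin a e₁) (Linear.·-hom lin b e₂))
        lemma : ∀ a b c d x₁ x₂ y₁ y₂ →
          (a * x₁ + b * y₁) * (c * x₂ + d * y₂) - (a * x₂ + b * y₂) * (c * x₁ + d * y₁)
            ≡ (a * d - b * c) * (x₁ * y₂ - x₂ * y₁)
        lemma = solve-∀

  det-linear : ∀ c → Linear (det c)
  det-linear c = record { ⊕-hom = det-⊕ c ; ·-hom = det-· c ; 0-hom = det-0 c }

  det-⊕-self : ∀ c h → det c (_⊕_ m c h) ≈ det c h
  det-⊕-self c h = ≈-trans (det-⊕ c c h)
    (≈-trans (+-cong (≡⇒≈ (det-self c)) (≈-refl {det c h})) (≡⇒≈ (ℤP.+-identityˡ _)))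

  det-affine-kernel : ∀ {c e₁} y e₂ → det c e₁ ≈ 0ℤ → det c (_⊕_ m (_·_ m y e₁) e₂) ≈ det c e₂
  det-affine-kernel {c} {e₁} y e₂ c∧e₁≈0 = ≈-trans (Linear.affine (det-linear c) y e₁ e₂)
    (≈-trans (+-cong (*-congˡ y c∧e₁≈0) (≈-refl {det c e₂})) (≡⇒≈ (lemma y (det c e₂))))
    where
      lemma : ∀ y a → y * 0ℤ + a ≡ a
      lemma = solve-∀

  -- Cramer's rule, inverting det c₁ c₂ modulo m.
  det-separates : ∀ {c₁ c₂ h k} → Unit (det c₁ c₂) →
                  det c₁ h ≈ det c₁ k → det c₂ h ≈ det c₂ k → h ≡ k
  det-separates {c₁} {c₂} {h} {k} u e₁ e₂ = K-≡
    (Unit-cancelʳ u (≈-trans (≡⇒≈ (cramer₁ c₁ c₂ h))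
      (≈-trans (-‿cong (*-congʳ (p₁ c₂) e₁) (*-congʳ (p₁ c₁) e₂)) (≡⇒≈ (sym (cramer₁ c₁ c₂ k))))))
    (Unit-cancelʳ u (≈-trans (≡⇒≈ (cramer₂ c₁ c₂ h))
      (≈-trans (-‿cong (*-congʳ (p₂ c₂) e₁) (*-congʳ (p₂ c₁) e₂)) (≡⇒≈ (sym (cramer₂ c₁ c₂ k))))))

  det-kernel⇒multiple : ∀ {e₁ e₂ g} → Unit (det e₁ e₂) → det e₁ g ≈ 0ℤ → ∃[ a ] g ≡ _·_ m a e₁
  det-kernel⇒multiple {e₁} {e₂} {g} u@(D⁻¹ , DD⁻¹≈1) e₁∧g≈0 = a , det-separates u against-e₁ against-e₂
    where
      open ≈-Reasoning
      a = det g e₂ * D⁻¹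
      against-e₁ : det e₁ g ≈ det e₁ (_·_ m a e₁)
      against-e₁ = begin
        det e₁ g               ≈⟨ e₁∧g≈0 ⟩
        0ℤ                     ≡⟨ ℤP.*-zeroʳ a ⟨
        a * 0ℤ                 ≡⟨ cong (a *_) (det-self e₁) ⟨
        a * det e₁ e₁          ≈⟨ det-· e₁ a e₁ ⟨
        det e₁ (_·_ m a e₁)    ∎
      against-e₂ : det e₂ g ≈ det e₂ (_·_ m a e₁)
      against-e₂ = begin
        det e₂ g                         ≡⟨ det-antisym e₂ g ⟩
        - det g e₂                       ≡⟨ cong -_ (ℤP.*-identityʳ (det g e₂)) ⟨
        - (det g e₂ * 1ℤ)                ≈⟨ neg-cong (*-congˡ (det g e₂) DD⁻¹≈1) ⟨
        - (det g e₂ * (det e₁ e₂ * D⁻¹)) ≡⟨ lemma (det g e₂) (det e₁ e₂) D⁻¹ ⟩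
        a * - det e₁ e₂                  ≡⟨ cong (a *_) (det-antisym e₂ e₁) ⟨
        a * det e₂ e₁                    ≈⟨ det-· e₂ a e₁ ⟨
        det e₂ (_·_ m a e₁)              ∎
        where
          lemma : ∀ x y z → - (x * (y * z)) ≡ x * z * - y
          lemma = solve-∀

  basis⇒Unit-det : ∀ {e₁ e₂} → IsBasis m e₁ e₂ → Unit (det e₁ e₂)
  basis⇒Unit-det {e₁} {e₂} (_ , _ , spans , _) with spans E₁ | spans E₂
    where
      E₁ E₂ : K m
      E₁ = red m 1ℤ , red m 0ℤ
      E₂ = red m 0ℤ , red m 1ℤ
  ... | a , b , E₁≡ | c , d , E₂≡ = a * d - b * c , (begin
    det e₁ e₂ * (a * d - b * c)    ≡⟨ ℤP.*-comm (det e₁ e₂) _ ⟩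
    (a * d - b * c) * det e₁ e₂    ≈⟨ det-lincomb a b c d e₁ e₂ ⟨
    det (_⊕_ m (_·_ m a e₁) (_·_ m b e₂)) (_⊕_ m (_·_ m c e₁) (_·_ m d e₂))
                                   ≡⟨ cong₂ det E₁≡ E₂≡ ⟨
    det (red m 1ℤ , red m 0ℤ) (red m 0ℤ , red m 1ℤ)
                                   ≈⟨ det-cong (red m 1ℤ , red m 0ℤ) (red m 0ℤ , red m 1ℤ)
                                        (⟦red⟧≈ 1ℤ) (⟦red⟧≈ 0ℤ) (⟦red⟧≈ 0ℤ) (⟦red⟧≈ 1ℤ) ⟩
    1ℤ                             ∎)
    where open ≈-Reasoning

  σ-m-copies : ∀ {k} h → suc k ≡ m → σ m (replicate k h ++ [ h ]) ≡ 0K m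
  σ-m-copies {k} h refl = linear-ext λ {π} lin → let open Linear lin in begin
    π (σ m (replicate k h ++ [ h ]))        ≈⟨ σ-hom (replicate k h ++ [ h ]) ⟩
    sumOf π (replicate k h ++ [ h ])        ≡⟨ sumOf-++ π (replicate k h) [ h ] ⟩
    sumOf π (replicate k h) + (π h + 0ℤ)    ≡⟨ cong₂ _+_ (sumOf-replicate π k h) (ℤP.+-identityʳ (π h)) ⟩
    + k * π h + π h                          ≡⟨ lemma (+ k) (π h) ⟩
    + suc k * π h                            ≈⟨ m*≈0 (π h) ⟩
    0ℤ                                       ≈⟨ 0-hom ⟨
    π (0K m)                                 ∎
    where
      open ≈-Reasoning
      lemma : ∀ k a → k * a + a ≡ (1ℤ + k) * a
      lemma = solve-∀

module _ {A : Set} where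

  map-allFin : ∀ {n} (F : Fin n → A) → map F (allFin n) ≡ tabulate F
  map-allFin F = LP.map-tabulate (λ i → i) F

  tabulate-↭-punchIn : ∀ {n} (F : Fin (suc n) → A) k → tabulate F ↭ F k ∷ tabulate (F ∘ Fin.punchIn k)
  tabulate-↭-punchIn F Fin.zero = ↭-refl
  tabulate-↭-punchIn {suc n} F (Fin.suc k) =
    ↭-trans (prep (F Fin.zero) (tabulate-↭-punchIn (F ∘ Fin.suc) k)) (swap (F Fin.zero) (F (Fin.suc k)) ↭-refl)

  tabulate-updateAt-↭ : ∀ {n} (F : Fin (suc n) → A) k φ →
    tabulate (updateAt F k φ) ↭ φ (F k) ∷ tabulate (F ∘ Fin.punchIn k)
  tabulate-updateAt-↭ F k φ = ↭-trans (tabulate-↭-punchIn (updateAt F k φ) k)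
    (↭-reflexive (cong₂ _∷_ (VFP.updateAt-updates k F) (LP.tabulate-cong off-k)))
    where
      off-k : updateAt F k φ ∘ Fin.punchIn k ≗ F ∘ Fin.punchIn k
      off-k i = VFP.updateAt-minimal (Fin.punchIn k i) k F (FinP.punchInᵢ≢i k i)

  swap-heads : ∀ (a b : A) xs ys → a ∷ xs ++ b ∷ ys ↭ b ∷ xs ++ a ∷ ys
  swap-heads a b xs ys = ↭-trans (prep a (PermP.shift b xs ys))
    (↭-trans (swap a b ↭-refl) (prep b (↭-sym (PermP.shift a xs ys))))

avoid-two : ∀ {n} (j k : Fin (suc (suc (suc n)))) → ∃[ ν ] ν ≢ j × ν ≢ k
avoid-two Fin.zero Fin.zero = Fin.suc Fin.zero , (λ ()) , (λ ())
avoid-two Fin.zero (Fin.suc Fin.zero) = Fin.suc (Fin.suc Fin.zero) , (λ ()) , (λ ())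
avoid-two Fin.zero (Fin.suc (Fin.suc _)) = Fin.suc Fin.zero , (λ ()) , (λ ())
avoid-two (Fin.suc Fin.zero) Fin.zero = Fin.suc (Fin.suc Fin.zero) , (λ ()) , (λ ())
avoid-two (Fin.suc Fin.zero) (Fin.suc _) = Fin.zero , (λ ()) , (λ ())
avoid-two (Fin.suc (Fin.suc _)) Fin.zero = Fin.suc Fin.zero , (λ ()) , (λ ())
avoid-two (Fin.suc (Fin.suc _)) (Fin.suc _) = Fin.zero , (λ ()) , (λ ())

module Counting {A : Set} (_≟_ : DecidableEquality A) where

  count : A → List A → ℕ
  count a xs = length (filter (_≟ a) xs)

  δ : A → A → ℕ
  δ a h with a ≟ h
  ... | yes _ = 1
  ... | no _ = 0

  δ-refl : ∀ h → δ h h ≡ 1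
  δ-refl h with h ≟ h
  ... | yes _ = refl
  ... | no h≢h = ⊥-elim (h≢h refl)

  δ-≢ : ∀ {a h} → a ≢ h → δ a h ≡ 0
  δ-≢ {a} {h} a≢h with a ≟ h
  ... | yes a≡h = ⊥-elim (a≢h a≡h)
  ... | no _ = refl

  δ≤1 : ∀ a h → δ a h ≤ 1
  δ≤1 a h with a ≟ h
  ... | yes _ = ℕP.≤-refl
  ... | no _ = z≤n

  δ≡1⇒≡ : ∀ {a h} → δ a h ≡ 1 → a ≡ h
  δ≡1⇒≡ {a} {h} δ≡1 with a ≟ h
  ... | yes a≡h = a≡h

  count-∷ : ∀ a h xs → count h (a ∷ xs) ≡ δ a h ℕ.+ count h xs
  count-∷ a h xs with a ≟ h
  ... | yes _ = refl
  ... | no _ = refl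

  count-++ : ∀ h xs ys → count h (xs ++ ys) ≡ count h xs ℕ.+ count h ys
  count-++ h xs ys = trans (cong length (LP.filter-++ (_≟ h) xs ys)) (LP.length-++ (filter (_≟ h) xs))

  count-replicate : ∀ h k a → count h (replicate k a) ≡ k ℕ.* δ a h
  count-replicate h zero a = refl
  count-replicate h (suc k) a = trans (count-∷ a h _) (cong (δ a h ℕ.+_) (count-replicate h k a))

  count-↭ : ∀ h {xs ys} → xs ↭ ys → count h xs ≡ count h ys
  count-↭ h xs↭ys = PermP.↭-length (PermP.filter-↭ (_≟ h) xs↭ys)

  count≤length : ∀ h xs → count h xs ≤ length xs
  count≤length h = LP.length-filter (_≟ h)

  count<length : ∀ {h x xs} → x ∈ xs → x ≢ h → count h xs ℕ.< length xs
  count<length {h} x∈xs x≢h = LP.filter-notAll (_≟ h) _ (Any.map (λ { refl → x≢h }) x∈xs)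

  ∈⇒count>0 : ∀ {h xs} → h ∈ xs → 0 ℕ.< count h xs
  ∈⇒count>0 {h} h∈xs = LP.filter-some (_≟ h) (Any.map sym h∈xs)

  count>0⇒∈ : ∀ {h} xs → 0 ℕ.< count h xs → h ∈ xs
  count>0⇒∈ {h} (a ∷ xs) c>0 with a ≟ h
  ... | yes a≡h = here (sym a≡h)
  ... | no _ = there (count>0⇒∈ xs c>0)

  ∉⇒count≡0 : ∀ {h xs} → (∀ {x} → x ∈ xs → x ≢ h) → count h xs ≡ 0
  ∉⇒count≡0 {h} {xs} ∉ = cong length (LP.filter-none (_≟ h) (All.tabulate ∉))

  sumOf-twoValued : ∀ π {a b} xs → (∀ {x} → x ∈ xs → x ≡ a ⊎ x ≡ b) →
    sumOf π xs ≡ + count a xs * π a + (+ length xs - + count a xs) * π b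
  sumOf-twoValued π [] _ = refl
  sumOf-twoValued π {a} {b} (x ∷ xs) two with x ≟ a | two (here refl) | sumOf-twoValued π xs (two ∘ there)
  ... | yes refl | _ | ih = trans (cong (_+_ (π x)) ih) (lemma (π x) (π b) (+ count x xs) (+ length xs))
    where
      lemma : ∀ u v c n → u + (c * u + (n - c) * v) ≡ (1ℤ + c) * u + ((1ℤ + n) - (1ℤ + c)) * v
      lemma = solve-∀
  ... | no x≢a | inj₁ x≡a | _ = ⊥-elim (x≢a x≡a)
  ... | no _ | inj₂ refl | ih = trans (cong (_+_ (π x)) ih) (lemma (π a) (π x) (+ count a xs) (+ length xs))
    where
      lemma : ∀ u v c n → v + (c * u + (n - c) * v) ≡ c * u + ((1ℤ + n) - c) * v
      lemma = solve-∀

  count-tabulate-punchIn : ∀ {n} h (F : Fin (suc n) → A) k →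
    count h (tabulate F) ≡ δ (F k) h ℕ.+ count h (tabulate (F ∘ Fin.punchIn k))
  count-tabulate-punchIn h F k = trans (count-↭ h (tabulate-↭-punchIn F k)) (count-∷ (F k) h _)

  count-updateAt≤ : ∀ {n} h (F : Fin (suc n) → A) k φ →
    count h (tabulate (updateAt F k φ)) ≤ suc (count h (tabulate F))
  count-updateAt≤ h F k φ = begin
    count h (tabulate (updateAt F k φ))                   ≡⟨ count-↭ h (tabulate-updateAt-↭ F k φ) ⟩
    count h (φ (F k) ∷ tabulate (F ∘ Fin.punchIn k))      ≡⟨ count-∷ (φ (F k)) h _ ⟩
    δ (φ (F k)) h ℕ.+ count h (tabulate (F ∘ Fin.punchIn k))
                                                          ≤⟨ ℕP.+-mono-≤ (δ≤1 (φ (F k)) h) (ℕP.m≤n+m _ (δ (F k) h)) ⟩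
    suc (δ (F k) h ℕ.+ count h (tabulate (F ∘ Fin.punchIn k)))
                                                          ≡⟨ cong suc (count-tabulate-punchIn h F k) ⟨
    suc (count h (tabulate F))                            ∎
    where open ℕP.≤-Reasoning

  count-tabulate-two-misses : ∀ {n} h (F : Fin (suc n) → A) {j k} → j ≢ k → F j ≢ h → F k ≢ h →
    count h (tabulate F) ℕ.< n
  count-tabulate-two-misses {n} h F {j} {k} j≢k Fj≢h Fk≢h = begin-strict
    count h (tabulate F)                                  ≡⟨ count-tabulate-punchIn h F k ⟩
    δ (F k) h ℕ.+ count h (tabulate (F ∘ Fin.punchIn k))  ≡⟨ cong (ℕ._+ count h (tabulate (F ∘ Fin.punchIn k))) (δ-≢ Fk≢h) ⟩
    count h (tabulate (F ∘ Fin.punchIn k))                <⟨ count<length Fj∈ Fj≢h ⟩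
    length (tabulate (F ∘ Fin.punchIn k))                 ≡⟨ LP.length-tabulate _ ⟩
    n                                                     ∎
    where
      open ℕP.≤-Reasoning
      Fj∈ : F j ∈ tabulate (F ∘ Fin.punchIn k)
      Fj∈ = subst (λ i → F i ∈ tabulate (F ∘ Fin.punchIn k)) (FinP.punchIn-punchOut (j≢k ∘ sym))
              (MemP.∈-tabulate⁺ (Fin.punchOut (j≢k ∘ sym)))

a+b≡2⇒a≡1 : ∀ {a b} → a ≤ 1 → b ≤ 1 → a ℕ.+ b ≡ 2 → a ≡ 1
a+b≡2⇒a≡1 (s≤s z≤n) _ _ = refl
a+b≡2⇒a≡1 z≤n z≤n ()
a+b≡2⇒a≡1 z≤n (s≤s z≤n) ()

a+[b+k]≡s+k⇒a+b≡s : ∀ a b {k s} → a ℕ.+ (b ℕ.+ k) ≡ s ℕ.+ k → a ℕ.+ b ≡ s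
a+[b+k]≡s+k⇒a+b≡s a b {k} {s} eq = ℕP.+-cancelʳ-≡ k (a ℕ.+ b) s (trans (ℕP.+-assoc a b k) eq)

a+[b+c]≡s+k⇒k≤c : ∀ a b {c s k} → a ℕ.+ b ≤ s → a ℕ.+ (b ℕ.+ c) ≡ s ℕ.+ k → k ≤ c
a+[b+c]≡s+k⇒k≤c a b {c} {s} {k} a+b≤s eq = ℕP.+-cancelˡ-≤ s k c (begin
  s ℕ.+ k              ≡⟨ eq ⟨
  a ℕ.+ (b ℕ.+ c)      ≡⟨ ℕP.+-assoc a b c ⟨
  a ℕ.+ b ℕ.+ c        ≤⟨ ℕP.+-monoˡ-≤ c a+b≤s ⟩
  s ℕ.+ c              ∎)
  where open ℕP.≤-Reasoning

∈-replicate⁻ : ∀ {A : Set} {x a : A} k → x ∈ replicate k a → x ≡ a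
∈-replicate⁻ (suc k) (here x≡a) = x≡a
∈-replicate⁻ (suc k) (there x∈) = ∈-replicate⁻ k x∈

module Υ-Structure (m : ℕ) .{{_ : NonZero m}} (1<m : 1 < m) where
  open Congruence m
  open Coordinates m
  -- With this decision procedure count is definitionally Defs' mult.
  open Counting (_≟K_ m)

  affine≢ : ∀ {e₁ e₂} → Unit (det e₁ e₂) → ∀ y → _⊕_ m (_·_ m y e₁) e₂ ≢ e₁
  affine≢ {e₁} {e₂} u y eq = Unit⇒≉0 1<m u (begin
    det e₁ e₂                          ≈⟨ det-affine-kernel y e₂ (≡⇒≈ (det-self e₁)) ⟨
    det e₁ (_⊕_ m (_·_ m y e₁) e₂)     ≡⟨ cong (det e₁) eq ⟩
    det e₁ e₁                          ≡⟨ det-self e₁ ⟩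
    0ℤ                                 ∎)
    where open ≈-Reasoning

  record ΥBasis (T : List (K m)) : Set where
    field
      e₁ e₂ : K m
      unimodular : Unit (det e₁ e₂)
      count-e₁ : count e₁ T ≡ m ∸ 1
      shape : ∀ {h} → h ∈ T → h ≡ e₁ ⊎ ∃[ y ] h ≡ _⊕_ m (_·_ m y e₁) e₂

    det-off-e₁ : ∀ {c h} → det c e₁ ≈ 0ℤ → h ∈ T → h ≢ e₁ → det c h ≈ det c e₂
    det-off-e₁ c∧e₁≈0 h∈T h≢e₁ with shape h∈T
    ... | inj₁ h≡e₁ = ⊥-elim (h≢e₁ h≡e₁)
    ... | inj₂ (y , refl) = det-affine-kernel y e₂ c∧e₁≈0

  Υ⇒ΥBasis : ∀ {T} → Υ m T → ΥBasis T
  Υ⇒ΥBasis {T} (_ , e₁ , e₂ , basis , y , _ , T↭) = record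
    { e₁ = e₁
    ; e₂ = e₂
    ; unimodular = unimodular
    ; count-e₁ = begin
        count e₁ T                                   ≡⟨ count-↭ e₁ T↭ ⟩
        count e₁ (replicate (m ∸ 1) e₁ ++ tail)      ≡⟨ count-++ e₁ (replicate (m ∸ 1) e₁) tail ⟩
        count e₁ (replicate (m ∸ 1) e₁) ℕ.+ count e₁ tail
                                                     ≡⟨ cong₂ ℕ._+_ (count-replicate e₁ (m ∸ 1) e₁) (∉⇒count≡0 e₁∉tail) ⟩
        (m ∸ 1) ℕ.* δ e₁ e₁ ℕ.+ 0                    ≡⟨ cong (λ k → (m ∸ 1) ℕ.* k ℕ.+ 0) (δ-refl e₁) ⟩
        (m ∸ 1) ℕ.* 1 ℕ.+ 0                          ≡⟨ trans (ℕP.+-identityʳ _) (ℕP.*-identityʳ (m ∸ 1)) ⟩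
        m ∸ 1                                        ∎
    ; shape = shape
    }
    where
      open ≡-Reasoning
      unimodular = basis⇒Unit-det basis
      point : Fin m → K m
      point ν = _⊕_ m (_·_ m (+ toℕ (y ν)) e₁) e₂
      tail = map point (allFin m)
      e₁∉tail : ∀ {h} → h ∈ tail → h ≢ e₁
      e₁∉tail h∈tail with MemP.∈-map⁻ point h∈tail
      ... | ν , _ , refl = affine≢ unimodular (+ toℕ (y ν))
      shape : ∀ {h} → h ∈ T → h ≡ e₁ ⊎ ∃[ y ] h ≡ _⊕_ m (_·_ m y e₁) e₂
      shape h∈T with MemP.∈-++⁻ (replicate (m ∸ 1) e₁) (PermP.∈-resp-↭ T↭ h∈T)
      ... | inj₁ h∈rep = inj₁ (∈-replicate⁻ (m ∸ 1) h∈rep)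
      ... | inj₂ h∈tail with MemP.∈-map⁻ point h∈tail
      ...   | ν , _ , h≡ = inj₂ (+ toℕ (y ν) , h≡)

module Lemma (n : ℕ) where

  m : ℕ
  m = suc (suc (suc (suc n)))

  1<m : 1 < m
  1<m = s≤s (s≤s z≤n)

  open Congruence m
  open Coordinates m
  open Counting (_≟K_ m)
  open Υ-Structure m 1<m

  module Assuming (f₁ f₂ : K m) (x : Fin m → ℤ) (S∈Υu : Υu m (seqS m f₁ f₂ x)) where

    t : Fin m → K m
    t = term m f₁ f₂ x

    ts S : List (K m)
    ts = map t (allFin m)
    S = seqS m f₁ f₂ x

    d : ℤ
    d = det f₁ f₂

    t∈ts : ∀ ν → t ν ∈ ts
    t∈ts ν = MemP.∈-map⁺ t (MemP.∈-allFin ν)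

    ts-index : ∀ {h} → h ∈ ts → ∃[ ν ] h ≡ t ν
    ts-index h∈ts with MemP.∈-map⁻ t h∈ts
    ... | ν , _ , h≡tν = ν , h≡tν

    length-ts : length ts ≡ m
    length-ts = trans (cong length (map-allFin t)) (LP.length-tabulate t)

    det-f₁-t : ∀ ν → det f₁ (t ν) ≈ d
    det-f₁-t ν = det-affine-kernel (x ν) f₂ (≡⇒≈ (det-self f₁))

    count-S : ∀ h → count h S ≡ (m ∸ 1) ℕ.* δ f₁ h ℕ.+ count h ts
    count-S h = trans (count-++ h (replicate (m ∸ 1) f₁) ts) (cong (ℕ._+ count h ts) (count-replicate h (m ∸ 1) f₁))

    S-min : MinZeroSum m S
    S-min = proj₁ (proj₁ S∈Υu)

    -- Otherwise f₁^m would be a proper zero-sum subsequence of S.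
    f₁∉ts : ¬ f₁ ∈ ts
    f₁∉ts f₁∈ts = proj₂ (proj₂ S-min) U U⊆S (λ ()) |U|<|S| (σ-m-copies f₁ refl)
      where
        U : List (K m)
        U = replicate (m ∸ 1) f₁ ++ [ f₁ ]
        U⊆S : U ⊆ S
        U⊆S = SubP.++⁺ (Sub.⊆-refl {x = replicate (m ∸ 1) f₁}) (Sub.from∈ f₁∈ts)
        |U|<|S| : length U < length S
        |U|<|S| = begin-strict
          length U                  ≡⟨ LP.length-++ (replicate (m ∸ 1) f₁) ⟩
          length (replicate (m ∸ 1) f₁) ℕ.+ 1 ≡⟨ cong (ℕ._+ 1) (LP.length-replicate (m ∸ 1)) ⟩
          (m ∸ 1) ℕ.+ 1             <⟨ ℕP.+-monoʳ-< (m ∸ 1) 1<m ⟩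
          (m ∸ 1) ℕ.+ m             ≡⟨ cong₂ ℕ._+_ (LP.length-replicate (m ∸ 1)) length-ts ⟨
          length (replicate (m ∸ 1) f₁) ℕ.+ length ts ≡⟨ LP.length-++ (replicate (m ∸ 1) f₁) ⟨
          length S                  ∎
          where open ℕP.≤-Reasoning

    t≢f₁ : ∀ ν → t ν ≢ f₁
    t≢f₁ ν tν≡f₁ = f₁∉ts (subst (_∈ ts) tν≡f₁ (t∈ts ν))

    count-f₁-ts : count f₁ ts ≡ 0
    count-f₁-ts = ∉⇒count≡0 λ { h∈ts refl → f₁∉ts h∈ts }

    count-f₁ : count f₁ S ≡ m ∸ 1
    count-f₁ = begin
      count f₁ S                                   ≡⟨ count-S f₁ ⟩
      (m ∸ 1) ℕ.* δ f₁ f₁ ℕ.+ count f₁ ts          ≡⟨ cong₂ (λ a b → (m ∸ 1) ℕ.* a ℕ.+ b) (δ-refl f₁) count-f₁-ts ⟩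
      (m ∸ 1) ℕ.* 1 ℕ.+ 0                          ≡⟨ trans (ℕP.+-identityʳ _) (ℕP.*-identityʳ (m ∸ 1)) ⟩
      m ∸ 1                                        ∎
      where open ≡-Reasoning

    S-unique : ∀ {h} → count h S ≡ m ∸ 1 → h ≡ f₁
    S-unique {h} c = trans (uniq h c) (sym (uniq f₁ count-f₁))
      where uniq = proj₂ (proj₂ (proj₂ S∈Υu))

    d-unit : Unit d
    d-unit = Unit-resp-≈ D≈d unimodular
      where
        open ΥBasis (Υ⇒ΥBasis (proj₁ S∈Υu))
        open ≈-Reasoning
        e₁≡f₁ : e₁ ≡ f₁
        e₁≡f₁ = S-unique count-e₁
        t₀∈S : t Fin.zero ∈ S
        t₀∈S = MemP.∈-++⁺ʳ (replicate (m ∸ 1) f₁) (t∈ts Fin.zero)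
        D≈d : det e₁ e₂ ≈ d
        D≈d = begin
          det e₁ e₂           ≈⟨ det-off-e₁ (≡⇒≈ (det-self e₁)) t₀∈S (λ t₀≡e₁ → t≢f₁ Fin.zero (trans t₀≡e₁ e₁≡f₁)) ⟨
          det e₁ (t Fin.zero) ≡⟨ cong (λ c → det c (t Fin.zero)) e₁≡f₁ ⟩
          det f₁ (t Fin.zero) ≈⟨ det-f₁-t Fin.zero ⟩
          d                   ∎

    d≉0 : ¬ d ≈ 0ℤ
    d≉0 = Unit⇒≉0 1<m d-unit

    sum-det-ts : ∀ c → + (m ∸ 1) * det c f₁ + sumOf (det c) ts ≈ 0ℤ
    sum-det-ts c = begin
      + (m ∸ 1) * det c f₁ + sumOf (det c) ts                    ≡⟨ cong (_+ sumOf (det c) ts) (sumOf-replicate (det c) (m ∸ 1) f₁) ⟨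
      sumOf (det c) (replicate (m ∸ 1) f₁) + sumOf (det c) ts    ≡⟨ sumOf-++ (det c) (replicate (m ∸ 1) f₁) ts ⟨
      sumOf (det c) S                                            ≈⟨ Linear.σ-hom (det-linear c) S ⟨
      det c (σ m S)                                              ≡⟨ cong (det c) (proj₁ (proj₂ S-min)) ⟩
      det c (0K m)                                               ≈⟨ det-0 c ⟩
      0ℤ                                                         ∎
      where open ≈-Reasoning

    count-S-ts : ∀ {h} → h ≢ f₁ → count h S ≡ count h ts
    count-S-ts {h} h≢f₁ = trans (count-S h) (trans
      (cong (λ k → (m ∸ 1) ℕ.* k ℕ.+ count h ts) (δ-≢ (h≢f₁ ∘ sym)))
      (cong (ℕ._+ count h ts) (ℕP.*-zeroʳ (m ∸ 1))))

    InPair : Fin m → K m → Set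
    InPair i h = h ≡ t i ⊎ h ≡ _⊕_ m (t i) f₁

    pair-unit : ∀ i → Unit (det f₁ (t i))
    pair-unit i = Unit-resp-≈ (≈-sym (det-f₁-t i)) d-unit

    W-unit : ∀ i → Unit (det (t i) f₁)
    W-unit i = Unit-resp-≈ (≡⇒≈ (sym (det-antisym (t i) f₁))) (Unit-neg {det f₁ (t i)} (pair-unit i))

    InPair-by-det : ∀ i {h} → det f₁ h ≈ d → det (t i) h ≈ 0ℤ ⊎ det (t i) h ≈ det (t i) f₁ → InPair i h
    InPair-by-det i {h} f₁∧h≈d (inj₁ tᵢ∧h≈0) = inj₁ (det-separates (pair-unit i)
      (≈-trans f₁∧h≈d (≈-sym (det-f₁-t i)))
      (≈-trans tᵢ∧h≈0 (≡⇒≈ (sym (det-self (t i))))))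
    InPair-by-det i {h} f₁∧h≈d (inj₂ tᵢ∧h≈W) =
      inj₂ (det-separates (pair-unit i) on-f₁ (≈-trans tᵢ∧h≈W (≈-sym (det-⊕-self (t i) f₁))))
      where
        open ≈-Reasoning
        on-f₁ : det f₁ h ≈ det f₁ (_⊕_ m (t i) f₁)
        on-f₁ = begin
          det f₁ h                        ≈⟨ f₁∧h≈d ⟩
          d                               ≡⟨ ℤP.+-identityʳ d ⟨
          d + 0ℤ                          ≈⟨ +-cong (det-f₁-t i) (≡⇒≈ (det-self f₁)) ⟨
          det f₁ (t i) + det f₁ f₁        ≈⟨ det-⊕ f₁ (t i) f₁ ⟨
          det f₁ (_⊕_ m (t i) f₁)         ∎

    sum-det-InPair : ∀ i L → (∀ {h} → h ∈ L → InPair i h) →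
      sumOf (det (t i)) L ≈ (+ length L - + count (t i) L) * det (t i) f₁
    sum-det-InPair i L in-pair = begin
      sumOf (det (t i)) L
        ≡⟨ sumOf-twoValued (det (t i)) L in-pair ⟩
      C * det (t i) (t i) + (N - C) * det (t i) (_⊕_ m (t i) f₁)
        ≈⟨ +-cong (≡⇒≈ (cong (C *_) (det-self (t i)))) (*-congˡ (N - C) (det-⊕-self (t i) f₁)) ⟩
      C * 0ℤ + (N - C) * det (t i) f₁
        ≡⟨ lemma C (N - C) (det (t i) f₁) ⟩
      (N - C) * det (t i) f₁ ∎
      where
        open ≈-Reasoning
        C = + count (t i) L
        N = + length L
        lemma : ∀ c k w → c * 0ℤ + k * w ≡ k * w
        lemma = solve-∀

    -- Summing det (t i) over S shows that t i would have multiplicity m - 1, contradicting uniqueness.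
    ts-not-in-pair : ∀ i → ¬ (∀ {h} → h ∈ ts → InPair i h)
    ts-not-in-pair i in-pair = t≢f₁ i (S-unique (trans (count-S-ts (t≢f₁ i)) M≡m-1))
      where
        open ≈-Reasoning
        M = count (t i) ts
        W = det (t i) f₁
        k = + (m ∸ 1)
        sum≈ : sumOf (det (t i)) ts ≈ (+ m - + M) * W
        sum≈ = ≈-trans (sum-det-InPair i ts in-pair) (≡⇒≈ (cong (λ l → (+ l - + M) * W) length-ts))
        lemma : ∀ k M W → (1ℤ + M) * W ≡ + 2 * ((1ℤ + k) * W) - (k * W + ((1ℤ + k) - M) * W)
        lemma = solve-∀
        two-m-W≈0 : + 2 * (+ m * W) ≈ 0ℤ
        two-m-W≈0 = ≈-trans (*-congˡ (+ 2) (m*≈0 W)) (≡⇒≈ (ℤP.*-zeroʳ (+ 2)))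
        [1+M]W≈0 : (1ℤ + + M) * W ≈ 0ℤ * W
        [1+M]W≈0 = begin
          (1ℤ + + M) * W                                ≡⟨ lemma k (+ M) W ⟩
          + 2 * (+ m * W) - (k * W + (+ m - + M) * W)   ≈⟨ -‿cong two-m-W≈0 (+-cong (≈-refl {k * W}) (≈-sym sum≈)) ⟩
          0ℤ - (k * W + sumOf (det (t i)) ts)           ≈⟨ -‿cong (≈-refl {0ℤ}) (sum-det-ts (t i)) ⟩
          0ℤ - 0ℤ                                       ≡⟨⟩
          0ℤ * W                                        ∎
        M≡m-1 : M ≡ m ∸ 1
        M≡m-1 = suc≈0⇒≡pred 1<m (subst (M ≤_) length-ts (count≤length (t i) ts)) (Unit-cancelʳ (W-unit i) [1+M]W≈0)

    det-f₁-ts : ∀ {h} → h ∈ ts → det f₁ h ≈ d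
    det-f₁-ts h∈ts = ≈-trans (≡⇒≈ (cong (det f₁) (proj₂ (ts-index h∈ts)))) (det-f₁-t (proj₁ (ts-index h∈ts)))

    -- The terms of T other than e₁ = t i all have the same determinant against t i as f₁ does.
    in-pair-of-e₁ : ∀ {T} (B : ΥBasis T) i → ΥBasis.e₁ B ≡ t i → f₁ ∈ T →
                    ∀ {h} → h ∈ T → h ∈ ts → InPair i h
    in-pair-of-e₁ B i e₁≡tᵢ f₁∈T {h} h∈T h∈ts = by-cases (_≟K_ m h (t i))
      where
        open ΥBasis B
        open ≈-Reasoning
        tᵢ∧e₁≈0 : det (t i) e₁ ≈ 0ℤ
        tᵢ∧e₁≈0 = ≡⇒≈ (trans (cong (det (t i)) e₁≡tᵢ) (det-self (t i)))
        by-cases : Dec (h ≡ t i) → InPair i h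
        by-cases (yes h≡tᵢ) = inj₁ h≡tᵢ
        by-cases (no h≢tᵢ) = InPair-by-det i (det-f₁-ts h∈ts) (inj₂ (begin
          det (t i) h      ≈⟨ det-off-e₁ tᵢ∧e₁≈0 h∈T (λ h≡e₁ → h≢tᵢ (trans h≡e₁ e₁≡tᵢ)) ⟩
          det (t i) e₂     ≈⟨ det-off-e₁ tᵢ∧e₁≈0 f₁∈T (λ f₁≡e₁ → t≢f₁ i (sym (trans f₁≡e₁ e₁≡tᵢ))) ⟨
          det (t i) f₁     ∎))

    rest : Fin m → List (K m)
    rest j = tabulate (t ∘ Fin.punchIn j)

    ts↭ : ∀ j → ts ↭ t j ∷ rest j
    ts↭ j = ↭-trans (↭-reflexive (map-allFin t)) (tabulate-↭-punchIn t j)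

    rest⊆ts : ∀ {j h} → h ∈ rest j → h ∈ ts
    rest⊆ts {j} h∈rest = PermP.∈-resp-↭ (↭-sym (ts↭ j)) (there h∈rest)

    -- As in ts-not-in-pair, but with the term t j set aside.
    det-t-from-rest : ∀ i j → (∀ {h} → h ∈ rest j → InPair i h) →
      det (t i) (t j) ≈ (+ 2 + + count (t i) (rest j)) * det (t i) f₁
    det-t-from-rest i j in-pair = begin
      X                                                       ≡⟨ lemma X W k c s ⟩
      (k * W + (X + s)) - (s - (k - c) * W) - + 2 * (+ m * W) + (+ 2 + c) * W
        ≈⟨ +-cong (-‿cong (-‿cong zero-sum rest-sum) (*-congˡ (+ 2) (m*≈0 W))) (≈-refl {(+ 2 + c) * W}) ⟩
      0ℤ - 0ℤ - + 2 * 0ℤ + (+ 2 + c) * W                      ≡⟨ ℤP.+-identityˡ _ ⟩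
      (+ 2 + c) * W                                           ∎
      where
        open ≈-Reasoning
        X = det (t i) (t j)
        W = det (t i) f₁
        k = + (m ∸ 1)
        c = + count (t i) (rest j)
        s = sumOf (det (t i)) (rest j)
        lemma : ∀ X W k c s → X ≡ (k * W + (X + s)) - (s - (k - c) * W) - + 2 * ((1ℤ + k) * W) + (+ 2 + c) * W
        lemma = solve-∀
        zero-sum : k * W + (X + s) ≈ 0ℤ
        zero-sum = ≈-trans (≡⇒≈ (cong (_+_ (k * W)) (sumOf-↭ (det (t i)) (↭-sym (ts↭ j))))) (sum-det-ts (t i))
        rest-sum : s - (k - c) * W ≈ 0ℤ
        rest-sum = ≈-trans
          (-‿cong (sum-det-InPair i (rest j) in-pair)
                  (≡⇒≈ (cong (λ l → (+ l - c) * W) (sym (LP.length-tabulate (t ∘ Fin.punchIn j))))))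
          (≡⇒≈ (ℤP.+-inverseʳ ((+ length (rest j) - c) * W)))

    -- T arises from S by trading a copy of f₁ and a term of ts for A and B; L lists the surviving terms of ts.
    module Traded (A B : K m) (r : ℕ) (L : List (K m)) (L⊆ts : ∀ {h} → h ∈ L → h ∈ ts)
                  {T : List (K m)} (T↭ : T ↭ A ∷ B ∷ replicate (suc r) f₁ ++ L) (ΥT : ΥBasis T) where
      open ΥBasis ΥT

      f₁∈T : f₁ ∈ T
      f₁∈T = PermP.∈-resp-↭ (↭-sym T↭) (there (there (here refl)))

      L⊆T : ∀ {h} → h ∈ L → h ∈ T
      L⊆T h∈L = PermP.∈-resp-↭ (↭-sym T↭) (there (there (MemP.∈-++⁺ʳ (replicate (suc r) f₁) h∈L)))

      count-T : ∀ h → count h T ≡ δ A h ℕ.+ (δ B h ℕ.+ (suc r ℕ.* δ f₁ h ℕ.+ count h L))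
      count-T h = begin
        count h T                                                  ≡⟨ count-↭ h T↭ ⟩
        count h (A ∷ B ∷ replicate (suc r) f₁ ++ L)                ≡⟨ count-∷ A h _ ⟩
        δ A h ℕ.+ count h (B ∷ replicate (suc r) f₁ ++ L)          ≡⟨ cong (δ A h ℕ.+_) (count-∷ B h _) ⟩
        δ A h ℕ.+ (δ B h ℕ.+ count h (replicate (suc r) f₁ ++ L))  ≡⟨ cong (λ c → δ A h ℕ.+ (δ B h ℕ.+ c)) (count-++ h (replicate (suc r) f₁) L) ⟩
        δ A h ℕ.+ (δ B h ℕ.+ (count h (replicate (suc r) f₁) ℕ.+ count h L))
                                                                   ≡⟨ cong (λ c → δ A h ℕ.+ (δ B h ℕ.+ (c ℕ.+ count h L))) (count-replicate h (suc r) f₁) ⟩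
        δ A h ℕ.+ (δ B h ℕ.+ (suc r ℕ.* δ f₁ h ℕ.+ count h L))    ∎
        where open ≡-Reasoning

      count-f₁-basis : f₁ ≡ e₁ → δ A f₁ ℕ.+ (δ B f₁ ℕ.+ suc r) ≡ m ∸ 1
      count-f₁-basis f₁≡e₁ = begin
        δ A f₁ ℕ.+ (δ B f₁ ℕ.+ suc r)                             ≡⟨ cong (λ c → δ A f₁ ℕ.+ (δ B f₁ ℕ.+ c)) copies ⟨
        δ A f₁ ℕ.+ (δ B f₁ ℕ.+ (suc r ℕ.* δ f₁ f₁ ℕ.+ count f₁ L)) ≡⟨ count-T f₁ ⟨
        count f₁ T                                                ≡⟨ cong (λ c → count c T) f₁≡e₁ ⟩
        count e₁ T                                                ≡⟨ count-e₁ ⟩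
        m ∸ 1                                                     ∎
        where
          open ≡-Reasoning
          copies : suc r ℕ.* δ f₁ f₁ ℕ.+ count f₁ L ≡ suc r
          copies = trans
            (cong₂ (λ a b → suc r ℕ.* a ℕ.+ b) (δ-refl f₁) (∉⇒count≡0 {xs = L} λ { h∈L refl → f₁∉ts (L⊆ts h∈L) }))
            (trans (ℕP.+-identityʳ _) (ℕP.*-identityʳ (suc r)))

      count-e₁-basis : f₁ ≢ e₁ → δ A e₁ ℕ.+ (δ B e₁ ℕ.+ count e₁ L) ≡ m ∸ 1
      count-e₁-basis f₁≢e₁ = begin
        δ A e₁ ℕ.+ (δ B e₁ ℕ.+ count e₁ L)                         ≡⟨ cong (λ c → δ A e₁ ℕ.+ (δ B e₁ ℕ.+ (c ℕ.+ count e₁ L))) no-copies ⟨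
        δ A e₁ ℕ.+ (δ B e₁ ℕ.+ (suc r ℕ.* δ f₁ e₁ ℕ.+ count e₁ L)) ≡⟨ count-T e₁ ⟨
        count e₁ T                                                ≡⟨ count-e₁ ⟩
        m ∸ 1                                                     ∎
        where
          open ≡-Reasoning
          no-copies : suc r ℕ.* δ f₁ e₁ ≡ 0
          no-copies = trans (cong (suc r ℕ.*_) (δ-≢ f₁≢e₁)) (ℕP.*-zeroʳ (suc r))

      count-t-basis : ∀ {i} → e₁ ≡ t i → δ A (t i) ℕ.+ (δ B (t i) ℕ.+ count (t i) L) ≡ m ∸ 1
      count-t-basis {i} e₁≡tᵢ = subst (λ e → δ A e ℕ.+ (δ B e ℕ.+ count e L) ≡ m ∸ 1) e₁≡tᵢ
        (count-e₁-basis (λ f₁≡e₁ → t≢f₁ i (sym (trans f₁≡e₁ e₁≡tᵢ))))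

      e₁-cases : f₁ ≡ e₁ ⊎ ∃[ i ] e₁ ≡ t i
      e₁-cases = by-cases (_≟K_ m f₁ e₁)
        where
          by-cases : Dec (f₁ ≡ e₁) → f₁ ≡ e₁ ⊎ ∃[ i ] e₁ ≡ t i
          by-cases (yes f₁≡e₁) = inj₁ f₁≡e₁
          by-cases (no f₁≢e₁) = inj₂ (ts-index (L⊆ts (count>0⇒∈ L (ℕP.≤-trans (s≤s z≤n)
            (a+[b+c]≡s+k⇒k≤c (δ A e₁) (δ B e₁) (ℕP.+-mono-≤ (δ≤1 A e₁) (δ≤1 B e₁)) (count-e₁-basis f₁≢e₁))))))

      L-in-pair : ∀ {i} → e₁ ≡ t i → ∀ {h} → h ∈ L → InPair i h
      L-in-pair {i} e₁≡tᵢ h∈L = in-pair-of-e₁ ΥT i e₁≡tᵢ f₁∈T (L⊆T h∈L) (L⊆ts h∈L)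

    module Part₁ (g : K m) where

      A B : K m
      A = _⊕_ m f₁ g
      B = _⊖_ m f₁ g

      S₁ : List (K m)
      S₁ = seq₁ m f₁ f₂ x g

      S₁-trivial : Υ m S₁ → g ≡ 0K m × S ↭ S₁
      S₁-trivial S₁∈Υ = g≡0 , ↭-reflexive (sym S₁≡S)
        where
          open Traded A B n ts (λ h∈ts → h∈ts) ↭-refl (Υ⇒ΥBasis S₁∈Υ)
          f₁≡e₁ : f₁ ≡ ΥBasis.e₁ (Υ⇒ΥBasis S₁∈Υ)
          f₁≡e₁ = [ (λ f₁≡e₁ → f₁≡e₁)
                  , (λ { (i , e₁≡tᵢ) → ⊥-elim (ts-not-in-pair i (L-in-pair e₁≡tᵢ)) }) ]′ e₁-cases
          g≡0 : g ≡ 0K m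
          g≡0 = ⊕-cancelˡ (δ≡1⇒≡ (a+b≡2⇒a≡1 (δ≤1 A f₁) (δ≤1 B f₁)
                  (a+[b+k]≡s+k⇒a+b≡s (δ A f₁) (δ B f₁) {suc n} {2} (count-f₁-basis f₁≡e₁))))
          S₁≡S : S₁ ≡ S
          S₁≡S = trans (cong (seq₁ m f₁ f₂ x) g≡0)
            (cong₂ (λ a b → a ∷ b ∷ replicate (suc n) f₁ ++ ts) (⊕-identityʳ f₁) (⊖-identityʳ f₁))

    module Part₂ (g : K m) (j : Fin m) where

      A B : K m
      A = _⊕_ m f₁ g
      B = _⊖_ m (t j) g

      rep : List (K m)
      rep = replicate (suc (suc n)) f₁

      S₂ : List (K m)
      S₂ = seq₂ m f₁ f₂ x g j

      updated↭ : map (updateAt t j (λ u → _⊖_ m u g)) (allFin m) ↭ B ∷ rest j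
      updated↭ = ↭-trans (↭-reflexive (map-allFin _)) (tabulate-updateAt-↭ t j _)

      S₂↭ : S₂ ↭ A ∷ rep ++ B ∷ rest j
      S₂↭ = prep A (PermP.++⁺ˡ rep updated↭)

      S₂↭-traded : S₂ ↭ A ∷ B ∷ rep ++ rest j
      S₂↭-traded = ↭-trans S₂↭ (prep A (PermP.shift B rep (rest j)))

      Conclusion : Set
      Conclusion = (g ≡ 0K m ⊎ g ≡ _⊕_ m (_·_ m (x j - + 1) f₁) f₂) × S ↭ S₂

      when-A≡f₁ : A ≡ f₁ → Conclusion
      when-A≡f₁ A≡f₁ = inj₁ g≡0 , ↭-reflexive (cong₂ (λ a L → a ∷ rep ++ L) (sym A≡f₁) (sym updated≡ts))
        where
          g≡0 = ⊕-cancelˡ A≡f₁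
          updated≡ts : map (updateAt t j (λ u → _⊖_ m u g)) (allFin m) ≡ ts
          updated≡ts = begin
            map (updateAt t j (λ u → _⊖_ m u g)) (allFin m)   ≡⟨ map-allFin _ ⟩
            tabulate (updateAt t j (λ u → _⊖_ m u g))         ≡⟨ LP.tabulate-cong (VFP.updateAt-id-local j t tⱼ⊖g≡tⱼ) ⟩
            tabulate t                                        ≡⟨ map-allFin t ⟨
            ts                                                ∎
            where
              open ≡-Reasoning
              tⱼ⊖g≡tⱼ : _⊖_ m (t j) g ≡ t j
              tⱼ⊖g≡tⱼ = trans (cong (_⊖_ m (t j)) g≡0) (⊖-identityʳ (t j))

      when-B≡f₁ : B ≡ f₁ → Conclusion
      when-B≡f₁ B≡f₁ = inj₂ g≡ , ↭-trans (prep f₁ (PermP.++⁺ˡ rep (ts↭ j)))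
        (↭-trans (swap-heads f₁ (t j) rep (rest j))
          (↭-sym (↭-trans S₂↭ (↭-reflexive (cong₂ (λ a b → a ∷ rep ++ b ∷ rest j) A≡tⱼ B≡f₁)))))
        where
          π-g : ∀ {π} → Linear π → π g ≈ π (t j) - π f₁
          π-g {π} lin = begin
            π g                        ≡⟨ lemma (π (t j)) (π g) ⟩
            π (t j) - (π (t j) - π g)  ≈⟨ -‿cong (≈-refl {π (t j)})
                                            (≈-trans (≈-sym (Linear.⊖-hom lin (t j) g)) (≡⇒≈ (cong π B≡f₁))) ⟩
            π (t j) - π f₁             ∎
            where
              open ≈-Reasoning
              lemma : ∀ a b → b ≡ a - (a - b)
              lemma = solve-∀
          g≡ : g ≡ _⊕_ m (_·_ m (x j - + 1) f₁) f₂
          g≡ = linear-ext λ {π} lin → begin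
            π g                              ≈⟨ π-g lin ⟩
            π (t j) - π f₁                   ≈⟨ -‿cong (Linear.affine lin (x j) f₁ f₂) (≈-refl {π f₁}) ⟩
            x j * π f₁ + π f₂ - π f₁         ≡⟨ lemma (x j) (π f₁) (π f₂) ⟩
            (x j - + 1) * π f₁ + π f₂        ≈⟨ Linear.affine lin (x j - + 1) f₁ f₂ ⟨
            π (_⊕_ m (_·_ m (x j - + 1) f₁) f₂) ∎
            where
              open ≈-Reasoning
              lemma : ∀ y a b → y * a + b - a ≡ (y - + 1) * a + b
              lemma = solve-∀
          A≡tⱼ : A ≡ t j
          A≡tⱼ = linear-ext λ {π} lin → begin
            π A                        ≈⟨ Linear.⊕-hom lin f₁ g ⟩
            π f₁ + π g                 ≈⟨ +-cong (≈-refl {π f₁}) (π-g lin) ⟩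
            π f₁ + (π (t j) - π f₁)    ≡⟨ lemma (π f₁) (π (t j)) ⟩
            π (t j)                    ∎
            where
              open ≈-Reasoning
              lemma : ∀ a b → a + (b - a) ≡ b
              lemma = solve-∀

      A≢tᵢ⊎B≢tᵢ : ∀ i → A ≢ t i ⊎ B ≢ t i
      A≢tᵢ⊎B≢tᵢ i = by-A (_≟K_ m A (t i))
        where
          open ≈-Reasoning
          lemma : ∀ a b → b ≡ a - (a - b)
          lemma = solve-∀
          both⇒⊥ : A ≡ t i → B ≡ t i → ⊥
          both⇒⊥ A≡tᵢ B≡tᵢ = d≉0 (begin
            d                       ≈⟨ det-f₁-t i ⟨
            det f₁ (t i)            ≡⟨ cong (det f₁) A≡tᵢ ⟨
            det f₁ A                ≈⟨ det-⊕-self f₁ g ⟩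
            det f₁ g                ≡⟨ lemma (det f₁ (t j)) (det f₁ g) ⟩
            det f₁ (t j) - (det f₁ (t j) - det f₁ g)
                                    ≈⟨ -‿cong (det-f₁-t j) (≈-sym (Linear.⊖-hom (det-linear f₁) (t j) g)) ⟩
            d - det f₁ B            ≡⟨ cong (λ h → d - det f₁ h) B≡tᵢ ⟩
            d - det f₁ (t i)        ≈⟨ -‿cong (≈-refl {d}) (det-f₁-t i) ⟩
            d - d                   ≡⟨ ℤP.+-inverseʳ d ⟩
            0ℤ                      ∎)
          by-A : Dec (A ≡ t i) → A ≢ t i ⊎ B ≢ t i
          by-A (yes A≡tᵢ) = inj₂ (both⇒⊥ A≡tᵢ)
          by-A (no A≢tᵢ) = inj₁ A≢tᵢ

      δA+δB≤1 : ∀ i → δ A (t i) ℕ.+ δ B (t i) ≤ 1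
      δA+δB≤1 i = [ (λ A≢tᵢ → subst (λ a → a ℕ.+ δ B (t i) ≤ 1) (sym (δ-≢ A≢tᵢ)) (δ≤1 B (t i)))
                  , (λ B≢tᵢ → subst (λ b → δ A (t i) ℕ.+ b ≤ 1) (sym (δ-≢ B≢tᵢ))
                      (ℕP.≤-trans (ℕP.≤-reflexive (ℕP.+-identityʳ _)) (δ≤1 A (t i)))) ]′ (A≢tᵢ⊎B≢tᵢ i)

      -- By det-t-from-rest, det (t i) (t j) is (2 + κ) det (t i) f₁ with κ ∈ {m - 2, m - 1}.
      tⱼ-in-pair : ∀ i → (∀ {h} → h ∈ rest j → InPair i h) → suc (suc n) ≤ count (t i) (rest j) → InPair i (t j)
      tⱼ-in-pair i rest-in-pair κ≥2+n = InPair-by-det i (det-f₁-t j) (by-κ κ≡)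
        where
          κ = count (t i) (rest j)
          κ≤3+n : κ ≤ suc (suc (suc n))
          κ≤3+n = subst (κ ≤_) (LP.length-tabulate (t ∘ Fin.punchIn j)) (count≤length (t i) (rest j))
          κ≡ : κ ≡ suc (suc n) ⊎ κ ≡ suc (suc (suc n))
          κ≡ = [ (λ 2+n<κ → inj₂ (ℕP.≤-antisym κ≤3+n 2+n<κ)) , (λ 2+n≡κ → inj₁ (sym 2+n≡κ)) ]′
                 (ℕP.m≤n⇒m<n∨m≡n κ≥2+n)
          W = det (t i) f₁
          open ≈-Reasoning
          by-κ : κ ≡ suc (suc n) ⊎ κ ≡ suc (suc (suc n)) → det (t i) (t j) ≈ 0ℤ ⊎ det (t i) (t j) ≈ W
          by-κ (inj₁ κ≡2+n) = inj₁ (begin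
            det (t i) (t j)    ≈⟨ det-t-from-rest i j rest-in-pair ⟩
            (+ 2 + + κ) * W    ≡⟨ cong (λ k → (+ 2 + + k) * W) κ≡2+n ⟩
            + m * W            ≈⟨ m*≈0 W ⟩
            0ℤ                 ∎)
          by-κ (inj₂ κ≡3+n) = inj₂ (begin
            det (t i) (t j)    ≈⟨ det-t-from-rest i j rest-in-pair ⟩
            (+ 2 + + κ) * W    ≡⟨ cong (λ k → (+ 2 + + k) * W) κ≡3+n ⟩
            (1ℤ + + m) * W     ≡⟨ ℤP.*-distribʳ-+ W 1ℤ (+ m) ⟩
            1ℤ * W + + m * W   ≈⟨ +-cong (≡⇒≈ (ℤP.*-identityˡ W)) (m*≈0 W) ⟩
            W + 0ℤ             ≡⟨ ℤP.+-identityʳ W ⟩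
            W                  ∎)

      S₂-trivial : Υ m S₂ → Conclusion
      S₂-trivial S₂∈Υ =
        [ f₁-basis , (λ { (i , e₁≡tᵢ) → ⊥-elim (ts-not-in-pair i (all-in-pair e₁≡tᵢ)) }) ]′ e₁-cases
        where
          open Traded A B (suc n) (rest j) rest⊆ts S₂↭-traded (Υ⇒ΥBasis S₂∈Υ)
          f₁-basis : f₁ ≡ ΥBasis.e₁ (Υ⇒ΥBasis S₂∈Υ) → Conclusion
          f₁-basis f₁≡e₁ = by-A (_≟K_ m A f₁)
            where
              by-A : Dec (A ≡ f₁) → Conclusion
              by-A (yes A≡f₁) = when-A≡f₁ A≡f₁
              by-A (no A≢f₁) = when-B≡f₁ (δ≡1⇒≡ (trans (cong (ℕ._+ δ B f₁) (sym (δ-≢ A≢f₁)))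
                (a+[b+k]≡s+k⇒a+b≡s (δ A f₁) (δ B f₁) {suc (suc n)} {1} (count-f₁-basis f₁≡e₁))))
          all-in-pair : ∀ {i} → ΥBasis.e₁ (Υ⇒ΥBasis S₂∈Υ) ≡ t i → ∀ {h} → h ∈ ts → InPair i h
          all-in-pair {i} e₁≡tᵢ h∈ts = in-pair-∷ (PermP.∈-resp-↭ (ts↭ j) h∈ts)
            where
              in-pair-∷ : ∀ {h} → h ∈ t j ∷ rest j → InPair i h
              in-pair-∷ (here refl) = tⱼ-in-pair i (L-in-pair e₁≡tᵢ)
                (a+[b+c]≡s+k⇒k≤c (δ A (t i)) (δ B (t i)) (δA+δB≤1 i) (count-t-basis e₁≡tᵢ))
              in-pair-∷ (there h∈rest) = L-in-pair e₁≡tᵢ h∈rest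

    module Part₃ (g : K m) (j k : Fin m) (j≢k : j ≢ k) where

      F₁ F₂ : Fin m → K m
      F₁ = updateAt t j (λ u → _⊕_ m u g)
      F₂ = updateAt F₁ k (λ u → _⊖_ m u g)

      S₃ : List (K m)
      S₃ = seq₃ m f₁ f₂ x g j k

      S₃-tail≡ : map F₂ (allFin m) ≡ tabulate F₂
      S₃-tail≡ = map-allFin F₂

      F₂∈S₃ : ∀ ν → F₂ ν ∈ S₃
      F₂∈S₃ ν = MemP.∈-++⁺ʳ (replicate (m ∸ 1) f₁) (MemP.∈-map⁺ F₂ (MemP.∈-allFin ν))

      count-S₃ : ∀ h → count h S₃ ≡ (m ∸ 1) ℕ.* δ f₁ h ℕ.+ count h (tabulate F₂)
      count-S₃ h = trans (count-++ h (replicate (m ∸ 1) f₁) _)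
        (cong₂ ℕ._+_ (count-replicate h (m ∸ 1) f₁) (cong (count h) S₃-tail≡))

      F₂-j : F₂ j ≡ _⊕_ m (t j) g
      F₂-j = trans (VFP.updateAt-minimal j k F₁ j≢k) (VFP.updateAt-updates j t)

      F₂-k : F₂ k ≡ _⊖_ m (t k) g
      F₂-k = trans (VFP.updateAt-updates k F₁) (cong (λ u → _⊖_ m u g) (VFP.updateAt-minimal k j t (j≢k ∘ sym)))

      F₂-other : ∀ {ν} → ν ≢ j → ν ≢ k → F₂ ν ≡ t ν
      F₂-other {ν} ν≢j ν≢k = trans (VFP.updateAt-minimal ν k F₁ ν≢k) (VFP.updateAt-minimal ν j t ν≢j)

      γ : ℤ
      γ = det f₁ g

      det-F₂-j : det f₁ (F₂ j) ≈ d + γ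
      det-F₂-j = ≈-trans (≡⇒≈ (cong (det f₁) F₂-j))
        (≈-trans (det-⊕ f₁ (t j) g) (+-cong (det-f₁-t j) (≈-refl {γ})))

      det-F₂-k : det f₁ (F₂ k) ≈ d - γ
      det-F₂-k = ≈-trans (≡⇒≈ (cong (det f₁) F₂-k))
        (≈-trans (Linear.⊖-hom (det-linear f₁) (t k) g) (-‿cong (det-f₁-t k) (≈-refl {γ})))

      count-f₁-tail≡0 : (B₃ : ΥBasis S₃) → f₁ ≡ ΥBasis.e₁ B₃ → count f₁ (tabulate F₂) ≡ 0
      count-f₁-tail≡0 B₃ f₁≡e₁ = ℕP.+-cancelˡ-≡ (m ∸ 1) _ 0 (begin
        (m ∸ 1) ℕ.+ count f₁ (tabulate F₂)               ≡⟨ cong (ℕ._+ count f₁ (tabulate F₂)) (ℕP.*-identityʳ (m ∸ 1)) ⟨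
        (m ∸ 1) ℕ.* 1 ℕ.+ count f₁ (tabulate F₂)         ≡⟨ cong (λ a → (m ∸ 1) ℕ.* a ℕ.+ count f₁ (tabulate F₂)) (δ-refl f₁) ⟨
        (m ∸ 1) ℕ.* δ f₁ f₁ ℕ.+ count f₁ (tabulate F₂)   ≡⟨ count-S₃ f₁ ⟨
        count f₁ S₃                                      ≡⟨ cong (λ c → count c S₃) f₁≡e₁ ⟩
        count (ΥBasis.e₁ B₃) S₃                          ≡⟨ ΥBasis.count-e₁ B₃ ⟩
        m ∸ 1                                            ≡⟨ ℕP.+-identityʳ (m ∸ 1) ⟨
        (m ∸ 1) ℕ.+ 0                                    ∎)
        where open ≡-Reasoning

      -- With f₁ = e₁, the terms t ν (ν ∉ {j, k}) and t j + g are both off e₁, so they share det f₁.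
      γ≈0-if-f₁-basis : (B₃ : ΥBasis S₃) → f₁ ≡ ΥBasis.e₁ B₃ → γ ≈ 0ℤ
      γ≈0-if-f₁-basis B₃ f₁≡e₁ = x+y≈x⇒y≈0 (begin
        d + γ             ≈⟨ det-F₂-j ⟨
        det f₁ (F₂ j)     ≈⟨ det-off-e₁ f₁∧e₁≈0 (F₂∈S₃ j) F₂j≢e₁ ⟩
        det f₁ e₂         ≈⟨ det-off-e₁ f₁∧e₁≈0 (F₂∈S₃ ν)
                               (λ F₂ν≡e₁ → t≢f₁ ν (trans (sym F₂ν≡tν) (trans F₂ν≡e₁ (sym f₁≡e₁)))) ⟨
        det f₁ (F₂ ν)     ≡⟨ cong (det f₁) F₂ν≡tν ⟩
        det f₁ (t ν)      ≈⟨ det-f₁-t ν ⟩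
        d                 ∎)
        where
          open ΥBasis B₃
          open ≈-Reasoning
          f₁∧e₁≈0 : det f₁ e₁ ≈ 0ℤ
          f₁∧e₁≈0 = ≡⇒≈ (trans (cong (det f₁) (sym f₁≡e₁)) (det-self f₁))
          ν = proj₁ (avoid-two j k)
          F₂ν≡tν = F₂-other (proj₁ (proj₂ (avoid-two j k))) (proj₂ (proj₂ (avoid-two j k)))
          F₂j≢e₁ : F₂ j ≢ e₁
          F₂j≢e₁ F₂j≡e₁ = ℕP.<⇒≢
            (∈⇒count>0 (subst (_∈ tabulate F₂) (trans F₂j≡e₁ (sym f₁≡e₁)) (MemP.∈-tabulate⁺ {f = F₂} j)))
            (sym (count-f₁-tail≡0 B₃ f₁≡e₁))

      -- Otherwise e₁ fills m - 1 of the m slots of the updated table, which is impossible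
      -- whether or not e₁ lies on the line det f₁ · ≈ d through the t ν.
      f₁-basis : ¬ γ ≈ 0ℤ → (B₃ : ΥBasis S₃) → f₁ ≡ ΥBasis.e₁ B₃
      f₁-basis γ≉0 B₃ with _≟K_ m f₁ (ΥBasis.e₁ B₃)
      ... | yes f₁≡e₁ = f₁≡e₁
      ... | no f₁≢e₁ = ⊥-elim (by-det-e₁ (≈-dec (det f₁ e₁) d))
        where
          open ΥBasis B₃
          count-e₁-tail : count e₁ (tabulate F₂) ≡ suc (suc (suc n))
          count-e₁-tail = begin
            count e₁ (tabulate F₂)                               ≡⟨ cong (ℕ._+ count e₁ (tabulate F₂)) (ℕP.*-zeroʳ (m ∸ 1)) ⟨
            (m ∸ 1) ℕ.* 0 ℕ.+ count e₁ (tabulate F₂)             ≡⟨ cong (λ a → (m ∸ 1) ℕ.* a ℕ.+ count e₁ (tabulate F₂)) (δ-≢ f₁≢e₁) ⟨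
            (m ∸ 1) ℕ.* δ f₁ e₁ ℕ.+ count e₁ (tabulate F₂)       ≡⟨ count-S₃ e₁ ⟨
            count e₁ S₃                                          ≡⟨ count-e₁ ⟩
            suc (suc (suc n))                                    ∎
            where open ≡-Reasoning
          by-det-e₁ : Dec (det f₁ e₁ ≈ d) → ⊥
          by-det-e₁ (yes f₁∧e₁≈d) = ℕP.<-irrefl count-e₁-tail (count-tabulate-two-misses e₁ F₂ j≢k F₂j≢e₁ F₂k≢e₁)
            where
              F₂j≢e₁ : F₂ j ≢ e₁
              F₂j≢e₁ F₂j≡e₁ =
                γ≉0 (x+y≈x⇒y≈0 (≈-trans (≈-sym det-F₂-j) (≈-trans (≡⇒≈ (cong (det f₁) F₂j≡e₁)) f₁∧e₁≈d)))
              F₂k≢e₁ : F₂ k ≢ e₁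
              F₂k≢e₁ F₂k≡e₁ =
                γ≉0 (x-y≈x⇒y≈0 (≈-trans (≈-sym det-F₂-k) (≈-trans (≡⇒≈ (cong (det f₁) F₂k≡e₁)) f₁∧e₁≈d)))
          by-det-e₁ (no f₁∧e₁≉d) = ℕP.<-irrefl refl (begin-strict
            3                                          ≤⟨ s≤s (s≤s (s≤s z≤n)) ⟩
            suc (suc (suc n))                          ≡⟨ count-e₁-tail ⟨
            count e₁ (tabulate F₂)                     ≤⟨ count-updateAt≤ e₁ F₁ k _ ⟩
            suc (count e₁ (tabulate F₁))               ≤⟨ s≤s (count-updateAt≤ e₁ t j _) ⟩
            suc (suc (count e₁ (tabulate t)))          ≡⟨ cong (λ c → suc (suc c)) no-e₁-in-ts ⟩
            2                                          <⟨ ℕP.n<1+n 2 ⟩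
            3                                          ∎)
            where
              open ℕP.≤-Reasoning
              no-e₁-in-ts : count e₁ (tabulate t) ≡ 0
              no-e₁-in-ts = ∉⇒count≡0 {xs = tabulate t}
                λ { h∈ts refl → f₁∧e₁≉d (det-f₁-ts (subst (e₁ ∈_) (sym (map-allFin t)) h∈ts)) }

      g∈⟨f₁⟩ : Υ m S₃ → ∃[ a ] g ≡ _·_ m a f₁
      g∈⟨f₁⟩ S₃∈Υ = det-kernel⇒multiple d-unit (γ≈0 (≈-dec γ 0ℤ))
        where
          B₃ = Υ⇒ΥBasis S₃∈Υ
          γ≈0 : Dec (γ ≈ 0ℤ) → γ ≈ 0ℤ
          γ≈0 (yes γ≈0) = γ≈0
          γ≈0 (no γ≉0) = ⊥-elim (γ≉0 (γ≈0-if-f₁-basis B₃ (f₁-basis γ≉0 B₃)))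

lemma3p1 : (m : ℕ) .{{_ : NonZero m}} → 4 ≤ m →
    (g f₁ f₂ : K m) (x : Fin m → ℤ) →
    Υu m (seqS m f₁ f₂ x) →
    ((Υ m (seq₁ m f₁ f₂ x g) →
        g ≡ 0K m × seqS m f₁ f₂ x ↭ seq₁ m f₁ f₂ x g)
    × (∀ (j : Fin m) → Υ m (seq₂ m f₁ f₂ x g j) →
        (g ≡ 0K m ⊎ g ≡ _⊕_ m (_·_ m (x j - + 1) f₁) f₂)
          × seqS m f₁ f₂ x ↭ seq₂ m f₁ f₂ x g j)
    × (∀ (j k : Fin m) → j ≢ k → Υ m (seq₃ m f₁ f₂ x g j k) →
        ∃[ a ] g ≡ _·_ m a f₁))
lemma3p1 (suc (suc (suc (suc n)))) (s≤s (s≤s (s≤s (s≤s z≤n)))) g f₁ f₂ x S∈Υu =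
    Part₁.S₁-trivial g
  , (λ j → Part₂.S₂-trivial g j)
  , (λ j k j≢k → Part₃.g∈⟨f₁⟩ g j k j≢k)
  where open Lemma.Assuming n f₁ f₂ x S∈Υu
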